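{- Let $\mathbb{K}$ be a commutative ring, $F=\mathbb{K}\{x_1,\dots,x_m\}$, $n\ge1$, $k\in\mathbb{N}$, $a_1,\dots,a_k\in F$ and $\alpha\in\mathbb{N}^k$ with $|\alpha|\le n$. Then $e^n_\alpha(a_1,\dots,a_k)$ belongs to the $\mathbb{K}$-subalgebra of $TS^n_{\mathbb{K}}(F)$ generated by the elements $e^n_i(\upsilon)$ with $i=1,\dots,n$ and $\upsilon$ a monomial (finite product of positive length) in $a_1,\dots,a_k$.
   Context: $TS^n_{\mathbb{K}}(F)=(F^{\otimes n})^{S_n}$. For $f_1,\dots,f_k\in F$ and $\beta\in\mathbb{N}^k$, $e^n_\beta(f_1,\dots,f_k)$ is the coefficient of $t_1^{\beta_1}\cdots t_k^{\beta_k}$ in $(1\otimes1+\sum_ht_h\otimes f_h)^{\otimes n}\in\mathbb{K}[t_1,\dots,t_k]\otimes_{\mathbb{K}}F^{\otimes n}$; $e^n_i(f)=e^n_{(i)}(f)$; $|\beta|=\sum\beta_h$. -}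

module Defs where

open import Level using (Level; _⊔_)
open import Algebra.Bundles using (CommutativeRing)
open import Data.Nat using (ℕ; zero; suc)
open import Data.Fin using (Fin; zero; suc)
import Data.Fin.Properties as FinP
open import Data.Product using (_×_; _,_)
open import Data.List using (List; []; _∷_; _++_; map; concatMap; filter; allFin; length; [_])
import Data.List.Properties as ListP
open import Data.Vec using (Vec; []; _∷_; lookup; tabulate; replicate; zipWith; toList)
import Data.Vec.Properties as VecP
import Data.Nat.Properties as NatP
open import Relation.Binary.Definitions using (DecidableEquality)
open import Relation.Nullary using (does)
open import Data.Bool using (if_then_else_)

-- Concrete model of the free associative (noncommutative) K-algebra
-- F = K{x_1,...,x_m} and of its tensor powers F^{⊗n}.
--  * F is the free K-module on words in the letters Fin m; an element is
--    represented by a finite formal sum, i.e. a list of (coefficient, word).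
--  * F^{⊗n} is the free K-module on n-tuples of words (the tensor product
--    of free modules is free on the product basis); an element is a list of
--    (coefficient, n-tuple of words).
sumℕ : {k : ℕ} → Vec ℕ k → ℕ
sumℕ = Data.Vec.foldr _ Data.Nat._+_ 0

module Model {c ℓ : Level} (K : CommutativeRing c ℓ) (m : ℕ) where
  open CommutativeRing K renaming (Carrier to R)

  Word : Set
  Word = List (Fin m)

  _≟W_ : DecidableEquality Word
  _≟W_ = ListP.≡-dec FinP._≟_

  Lin : Set → Set c
  Lin B = List (R × B)

  coeff : {B : Set} → DecidableEquality B → Lin B → B → R
  coeff _≟_ [] b = 0#
  coeff _≟_ ((r , b′) ∷ xs) b = (if does (b′ ≟ b) then r else 0#) + coeff _≟_ xs b

  F : Set c
  F = Lin Word

  _·F_ : F → F → F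
  x ·F y = concatMap (λ { (r , u) → map (λ { (s , v) → (r * s , u ++ v) }) y }) x

  Basis : ℕ → Set
  Basis n = Vec Word n

  _≟B_ : {n : ℕ} → DecidableEquality (Basis n)
  _≟B_ = VecP.≡-dec _≟W_

  T : ℕ → Set c
  T n = Lin (Basis n)

  _≈T_ : {n : ℕ} → T n → T n → Set ℓ
  x ≈T y = ∀ b → coeff _≟B_ x b ≈ coeff _≟B_ y b

  _+T_ : {n : ℕ} → T n → T n → T n
  x +T y = x ++ y

  _•T_ : {n : ℕ} → R → T n → T n
  r •T x = map (λ { (s , b) → (r * s , b) }) x

  _·T_ : {n : ℕ} → T n → T n → T n
  x ·T y = concatMap (λ { (r , u) → map (λ { (s , v) → (r * s , zipWith _++_ u v) }) y }) x

  1T : {n : ℕ} → T n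
  1T {n} = [ (1# , replicate n []) ]

  ⊗ : {n : ℕ} → Vec F n → T n
  ⊗ [] = [ (1# , []) ]
  ⊗ (f ∷ fs) = concatMap (λ { (r , w) → map (λ { (s , ws) → (r * s , w ∷ ws) }) (⊗ fs) }) f

  allVecs : (s n : ℕ) → List (Vec (Fin s) n)
  allVecs s zero = [ [] ]
  allVecs s (suc n) = concatMap (λ i → map (i ∷_) (allVecs s n)) (allFin s)

  -- e^n_β(f_1,...,f_k): the coefficient of t^β in (1⊗1 + Σ_h t_h ⊗ f_h)^{⊗n}.
  -- Expanding the tensor power, it is the sum over all choices
  -- σ : positions 1..n → {0,1,...,k} (0 = the term 1, h+1 = the term t_h f_h)
  -- such that the letter h+1 occurs exactly β_h times, of
  -- g_{σ(1)} ⊗ ... ⊗ g_{σ(n)} with g_0 = 1, g_{h+1} = f_h.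
  choose : {k : ℕ} → Vec F k → Fin (suc k) → F
  choose fs zero = [ (1# , []) ]
  choose fs (suc h) = lookup fs h

  count : {s n : ℕ} → Fin s → Vec (Fin s) n → ℕ
  count i σ = length (filter (λ j → j FinP.≟ i) (toList σ))

  exponents : {k n : ℕ} → Vec (Fin (suc k)) n → Vec ℕ k
  exponents σ = tabulate (λ h → count (suc h) σ)

  e : (n : ℕ) {k : ℕ} → Vec F k → Vec ℕ k → T n
  e n {k} fs β =
    concatMap (λ σ → ⊗ (Data.Vec.map (choose fs) σ))
      (filter (λ σ → VecP.≡-dec NatP._≟_ (exponents σ) β) (allVecs (suc k) n))

  e₁ : (n : ℕ) → ℕ → F → T n
  e₁ n i f = e n (f ∷ []) (i ∷ [])

  -- the monomial a_{j_0} a_{j_1} ... a_{j_r} (positive length)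
  mono : {k : ℕ} → Vec F k → Fin k → List (Fin k) → F
  mono a j [] = lookup a j
  mono a j (j′ ∷ js) = lookup a j ·F mono a j′ js

  -- the K-subalgebra of F^{⊗n} (hence of TS^n(F), since all generators are
  -- symmetric) generated by e^n_i(υ), 1 ≤ i ≤ n, υ a monomial in a_1..a_k
  data InSubalg (n : ℕ) {k : ℕ} (a : Vec F k) : T n → Set (c ⊔ ℓ) where
    gen   : (i : ℕ) → 1 Data.Nat.≤ i → i Data.Nat.≤ n →
            (j : Fin k) (js : List (Fin k)) → InSubalg n a (e₁ n i (mono a j js))
    unit  : InSubalg n a 1T
    add   : ∀ {x y} → InSubalg n a x → InSubalg n a y → InSubalg n a (x +T y)
    mul   : ∀ {x y} → InSubalg n a x → InSubalg n a y → InSubalg n a (x ·T y)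
    scal  : ∀ r {x} → InSubalg n a x → InSubalg n a (r •T x)
    resp  : ∀ {x y} → x ≈T y → InSubalg n a x → InSubalg n a y

-- Induction on |α|.  A variable with exponent 0 can be dropped, so let α = (j , β) with j ≥ 1 and
-- write the variables as (g , b₁ … b_l).  Multiplying e_j(g) and e_β(b) tensor factor by tensor
-- factor gives the product formula
--   e_j(g) · e_β(b) = Σ_κ e_κ(g , b₁ … b_l , g b₁ … g b_l),
-- summed over the exponents κ in which g occurs j times in total and each b_h occurs β_h times.
-- The term κ = (j , β , 0) is e_α(g , b).  Every other κ has |κ| < |α|, and its variables are again
-- monomials in a₁ … a_k, so by induction all these terms, and e_j(g) · e_β(b), lie in the subalgebra.

module Submission where

open import Defs
open import Level using (Level; _⊔_)
open import Algebra.Bundles using (CommutativeRing; CommutativeSemiring)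
import Algebra.Properties.CommutativeSemigroup as CommSemigroupProps
import Algebra.Properties.Ring as RingProps
open import Data.Bool using (if_then_else_)
open import Data.Empty using (⊥-elim)
open import Data.Fin as Fin using (Fin; zero; suc; toℕ; _↑ˡ_; _↑ʳ_)
import Data.Fin.Properties as FinP
open import Data.List as List using (List; []; _∷_; _++_; drop; length; allFin; cartesianProduct)
import Data.List.Properties as ListP
open import Data.Nat as Nat using (ℕ; zero; suc; z≤n; s≤s; _≤_)
open import Data.Nat.Induction using (<-wellFounded)
import Data.Nat.Properties as NatP
open import Data.Product using (Σ; _×_; _,_; proj₁; proj₂; uncurry)
import Data.Product.Properties as ProdP
open import Data.Sum using (_⊎_; inj₁; inj₂; [_,_]′)
open import Data.Vec as Vec using (Vec; []; _∷_)
import Data.Vec.Properties as VecP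
open import Data.Vec.Relation.Binary.Pointwise.Extensional using (ext; Pointwise-≡⇒≡)
open import Function using (_∘_; _⇔_; mk⇔; Equivalence)
open import Function.Definitions using (Injective)
open import Induction.WellFounded using (Acc; acc)
open import Relation.Binary.Definitions using (DecidableEquality)
open import Relation.Binary.PropositionalEquality as ≡ using (_≡_; _≢_)
open import Relation.Nullary using (Dec; yes; no; does; ¬_)
open import Relation.Nullary.Decidable using (_×-dec_; ¬?)

module IndicatorSums {c ℓ : Level} (S : CommutativeSemiring c ℓ) where
  open CommutativeSemiring S renaming (Carrier to R) hiding (zero)
  open import Relation.Binary.Reasoning.Setoid setoid

  ⟦_⟧ : ∀ {p} {P : Set p} → Dec P → R
  ⟦ yes _ ⟧ = 1#
  ⟦ no _ ⟧ = 0#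

  module _ {p q} {P : Set p} {Q : Set q} where

    ⟦⟧-cong : P ⇔ Q → (P? : Dec P) (Q? : Dec Q) → ⟦ P? ⟧ ≡ ⟦ Q? ⟧
    ⟦⟧-cong P⇔Q (yes _) (yes _) = ≡.refl
    ⟦⟧-cong P⇔Q (yes p) (no ¬q) = ⊥-elim (¬q (Equivalence.to P⇔Q p))
    ⟦⟧-cong P⇔Q (no ¬p) (yes q) = ⊥-elim (¬p (Equivalence.from P⇔Q q))
    ⟦⟧-cong P⇔Q (no _) (no _) = ≡.refl

    ⟦⟧-× : (P? : Dec P) (Q? : Dec Q) → ⟦ P? ×-dec Q? ⟧ ≈ ⟦ P? ⟧ * ⟦ Q? ⟧
    ⟦⟧-× (yes _) (yes _) = sym (*-identityˡ 1#)
    ⟦⟧-× (yes _) (no _) = sym (zeroʳ 1#)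
    ⟦⟧-× (no _) _ = sym (zeroˡ _)

  ⟦⟧-split : ∀ {p q} {P : Set p} {Q : Set q} → (Q → P) → (P? : Dec P) (Q? : Dec Q) →
             ⟦ P? ⟧ ≈ ⟦ Q? ⟧ + ⟦ P? ×-dec ¬? Q? ⟧
  ⟦⟧-split Q⇒P (yes _) (yes _) = sym (+-identityʳ 1#)
  ⟦⟧-split Q⇒P (yes _) (no _) = sym (+-identityˡ 1#)
  ⟦⟧-split Q⇒P (no ¬p) (yes q) = ⊥-elim (¬p (Q⇒P q))
  ⟦⟧-split Q⇒P (no _) (no _) = sym (+-identityˡ 0#)

  ⟦⟧-yes : ∀ {p} {P : Set p} (P? : Dec P) → P → ⟦ P? ⟧ ≡ 1#
  ⟦⟧-yes (yes _) _ = ≡.refl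
  ⟦⟧-yes (no ¬p) p = ⊥-elim (¬p p)

  if-does≈*⟦⟧ : ∀ {p} {P : Set p} (P? : Dec P) (r : R) → (if does P? then r else 0#) ≈ r * ⟦ P? ⟧
  if-does≈*⟦⟧ (yes _) r = sym (*-identityʳ r)
  if-does≈*⟦⟧ (no _) r = sym (zeroʳ r)

  ∑ : ∀ {a} {A : Set a} → List A → (A → R) → R
  ∑ [] f = 0#
  ∑ (x ∷ xs) f = f x + ∑ xs f

  syntax ∑ xs (λ x → e) = ∑[ x ∈ xs ] e

  module _ {a} {A : Set a} where

    ∑-cong : (xs : List A) {f g : A → R} → (∀ x → f x ≈ g x) → ∑ xs f ≈ ∑ xs g
    ∑-cong [] f≈g = refl
    ∑-cong (x ∷ xs) f≈g = +-cong (f≈g x) (∑-cong xs f≈g)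

    ∑-++ : (xs ys : List A) (f : A → R) → ∑ (xs ++ ys) f ≈ ∑ xs f + ∑ ys f
    ∑-++ [] ys f = sym (+-identityˡ _)
    ∑-++ (x ∷ xs) ys f = trans (+-congˡ (∑-++ xs ys f)) (sym (+-assoc _ _ _))

    ∑-0# : (xs : List A) → ∑[ x ∈ xs ] 0# ≈ 0#
    ∑-0# [] = refl
    ∑-0# (x ∷ xs) = trans (+-identityˡ _) (∑-0# xs)

    ∑-+ : (xs : List A) (f g : A → R) → ∑[ x ∈ xs ] (f x + g x) ≈ ∑ xs f + ∑ xs g
    ∑-+ [] f g = sym (+-identityˡ _)
    ∑-+ (x ∷ xs) f g =
      trans (+-congˡ (∑-+ xs f g)) (CommSemigroupProps.interchange +-commutativeSemigroup _ _ _ _)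

    ∑-*ˡ : (xs : List A) (r : R) (f : A → R) → r * ∑ xs f ≈ ∑[ x ∈ xs ] (r * f x)
    ∑-*ˡ [] r f = zeroʳ r
    ∑-*ˡ (x ∷ xs) r f = trans (distribˡ r _ _) (+-congˡ (∑-*ˡ xs r f))

    ∑-*ʳ : (xs : List A) (r : R) (f : A → R) → ∑ xs f * r ≈ ∑[ x ∈ xs ] (f x * r)
    ∑-*ʳ xs r f = trans (*-comm _ r) (trans (∑-*ˡ xs r f) (∑-cong xs (λ x → *-comm r (f x))))

    ∑-filter : ∀ {p} {P : A → Set p} (P? : ∀ x → Dec (P x)) (xs : List A) (f : A → R) →
               ∑ (List.filter P? xs) f ≈ ∑[ x ∈ xs ] (⟦ P? x ⟧ * f x)
    ∑-filter P? [] f = refl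
    ∑-filter P? (x ∷ xs) f with P? x
    ... | yes _ = +-cong (sym (*-identityˡ _)) (∑-filter P? xs f)
    ... | no _ = trans (∑-filter P? xs f) (trans (sym (+-identityˡ _)) (+-congʳ (sym (zeroˡ _))))

    ∑-map : ∀ {b} {B : Set b} (g : B → A) (xs : List B) (f : A → R) → ∑ (List.map g xs) f ≡ ∑ xs (f ∘ g)
    ∑-map g [] f = ≡.refl
    ∑-map g (x ∷ xs) f = ≡.cong (f (g x) +_) (∑-map g xs f)

    ∑-concatMap : ∀ {b} {B : Set b} (g : B → List A) (xs : List B) (f : A → R) →
                  ∑ (List.concatMap g xs) f ≈ ∑[ x ∈ xs ] ∑ (g x) f
    ∑-concatMap g [] f = refl
    ∑-concatMap g (x ∷ xs) f = trans (∑-++ (g x) _ f) (+-congˡ (∑-concatMap g xs f))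

  ∑-swap : ∀ {a b} {A : Set a} {B : Set b} (xs : List A) (ys : List B) (f : A → B → R) →
           ∑[ x ∈ xs ] ∑[ y ∈ ys ] f x y ≈ ∑[ y ∈ ys ] ∑[ x ∈ xs ] f x y
  ∑-swap [] ys f = sym (∑-0# ys)
  ∑-swap (x ∷ xs) ys f = trans (+-congˡ (∑-swap xs ys f)) (sym (∑-+ ys (f x) _))

  *-interchange : ∀ a b c d → (a * b) * (c * d) ≈ (a * c) * (b * d)
  *-interchange = CommSemigroupProps.interchange *-commutativeSemigroup

  ∑-*-∑ : ∀ {a b} {A : Set a} {B : Set b} (xs : List A) (ys : List B) (f : A → R) (g : B → R) →
          ∑ xs f * ∑ ys g ≈ ∑[ x ∈ xs ] ∑[ y ∈ ys ] (f x * g y)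
  ∑-*-∑ xs ys f g = trans (∑-*ʳ xs _ f) (∑-cong xs (λ x → ∑-*ˡ ys (f x) g))

  ⟦≡-dec-∷⟧ : ∀ {a} {A : Set a} (_≟_ : DecidableEquality A) {n} (x y : A) (xs ys : Vec A n) →
              ⟦ VecP.≡-dec _≟_ (x ∷ xs) (y ∷ ys) ⟧ ≈ ⟦ x ≟ y ⟧ * ⟦ VecP.≡-dec _≟_ xs ys ⟧
  ⟦≡-dec-∷⟧ _≟_ x y xs ys = trans
    (reflexive (⟦⟧-cong (mk⇔ (λ eq → VecP.∷-injectiveˡ eq , VecP.∷-injectiveʳ eq) (λ { (≡.refl , ≡.refl) → ≡.refl }))
                        (VecP.≡-dec _≟_ (x ∷ xs) (y ∷ ys)) ((x ≟ y) ×-dec VecP.≡-dec _≟_ xs ys)))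
    (⟦⟧-× (x ≟ y) (VecP.≡-dec _≟_ xs ys))

  record Enumerates {a} {A : Set a} (_≟_ : DecidableEquality A) (xs : List A) : Set (a ⊔ c ⊔ ℓ) where
    field
      ∑-sift : ∀ (x₀ : A) (g : A → R) → ∑[ x ∈ xs ] (⟦ x ≟ x₀ ⟧ * g x) ≈ g x₀
  open Enumerates public

  ∑-reindex : ∀ {a b} {A : Set a} {B : Set b} {_≟A_ : DecidableEquality A} {_≟B_ : DecidableEquality B}
              {xs : List A} {ys : List B} → Enumerates _≟A_ xs → Enumerates _≟B_ ys →
              (φ : A → B) → (∀ {x x′} → φ x ≡ φ x′ → x ≡ x′) → (f : B → R) →
              (∀ y → Σ A (λ x → φ x ≡ y) ⊎ f y ≈ 0#) →
              ∑ ys f ≈ ∑[ x ∈ xs ] f (φ x)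
  ∑-reindex {_≟A_ = _≟A_} {_≟B_} {xs} {ys} enum-xs enum-ys φ φ-injective f covers = begin
    ∑ ys f                                          ≈⟨ ∑-cong ys fibre-sum ⟨
    ∑[ y ∈ ys ] ∑[ x ∈ xs ] (⟦ y ≟B φ x ⟧ * f y)    ≈⟨ ∑-swap xs ys _ ⟨
    ∑[ x ∈ xs ] ∑[ y ∈ ys ] (⟦ y ≟B φ x ⟧ * f y)    ≈⟨ ∑-cong xs (λ x → ∑-sift enum-ys (φ x) f) ⟩
    ∑[ x ∈ xs ] f (φ x)                             ∎
    where
    fibre-sum : ∀ y → ∑[ x ∈ xs ] (⟦ y ≟B φ x ⟧ * f y) ≈ f y
    fibre-sum y with covers y
    ... | inj₁ (x₀ , ≡.refl) = trans
          (∑-cong xs (λ x → *-congʳ (reflexive (⟦⟧-cong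
             (mk⇔ (λ eq → ≡.sym (φ-injective eq)) (λ eq → ≡.cong φ (≡.sym eq))) (φ x₀ ≟B φ x) (x ≟A x₀)))))
          (∑-sift enum-xs x₀ (λ _ → f (φ x₀)))
    ... | inj₂ fy≈0 = trans (∑-cong xs (λ x → trans (*-congˡ fy≈0) (zeroʳ _))) (trans (∑-0# xs) (sym fy≈0))

  ∑-cartesianProduct : ∀ {a b} {A : Set a} {B : Set b} (xs : List A) (ys : List B) (f : A × B → R) →
                       ∑ (cartesianProduct xs ys) f ≈ ∑[ x ∈ xs ] ∑[ y ∈ ys ] f (x , y)
  ∑-cartesianProduct [] ys f = refl
  ∑-cartesianProduct (x ∷ xs) ys f = begin
    ∑ (List.map (x ,_) ys ++ cartesianProduct xs ys) f           ≈⟨ ∑-++ (List.map (x ,_) ys) _ f ⟩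
    ∑ (List.map (x ,_) ys) f + ∑ (cartesianProduct xs ys) f
      ≈⟨ +-cong (reflexive (∑-map (x ,_) ys f)) (∑-cartesianProduct xs ys f) ⟩
    ∑[ y ∈ ys ] f (x , y) + ∑[ x′ ∈ xs ] ∑[ y ∈ ys ] f (x′ , y) ∎

  cartesianProduct-enumerates : ∀ {a b} {A : Set a} {B : Set b} {_≟A_ : DecidableEquality A} {_≟B_ : DecidableEquality B}
    {xs : List A} {ys : List B} → Enumerates _≟A_ xs → Enumerates _≟B_ ys →
    Enumerates (ProdP.≡-dec _≟A_ _≟B_) (cartesianProduct xs ys)
  ∑-sift (cartesianProduct-enumerates {_≟A_ = _≟A_} {_≟B_} {xs} {ys} enum-xs enum-ys) (x₀ , y₀) g = begin
    ∑[ p ∈ cartesianProduct xs ys ] (⟦ ProdP.≡-dec _≟A_ _≟B_ p (x₀ , y₀) ⟧ * g p)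
      ≈⟨ ∑-cartesianProduct xs ys _ ⟩
    ∑[ x ∈ xs ] ∑[ y ∈ ys ] (⟦ ProdP.≡-dec _≟A_ _≟B_ (x , y) (x₀ , y₀) ⟧ * g (x , y))
      ≈⟨ ∑-cong xs (λ x → ∑-cong ys (λ y → trans (*-congʳ (⟦pair≟pair⟧ x y)) (*-assoc _ _ _))) ⟩
    ∑[ x ∈ xs ] ∑[ y ∈ ys ] (⟦ x ≟A x₀ ⟧ * (⟦ y ≟B y₀ ⟧ * g (x , y)))
      ≈⟨ ∑-cong xs (λ x → trans (sym (∑-*ˡ ys _ _)) (*-congˡ (∑-sift enum-ys y₀ (λ y → g (x , y))))) ⟩
    ∑[ x ∈ xs ] (⟦ x ≟A x₀ ⟧ * g (x , y₀))
      ≈⟨ ∑-sift enum-xs x₀ (λ x → g (x , y₀)) ⟩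
    g (x₀ , y₀) ∎
    where
    ⟦pair≟pair⟧ : ∀ x y → ⟦ ProdP.≡-dec _≟A_ _≟B_ (x , y) (x₀ , y₀) ⟧ ≈ ⟦ x ≟A x₀ ⟧ * ⟦ y ≟B y₀ ⟧
    ⟦pair≟pair⟧ x y = trans
      (reflexive (⟦⟧-cong (mk⇔ (λ { ≡.refl → ≡.refl , ≡.refl }) (λ { (≡.refl , ≡.refl) → ≡.refl }))
                          (ProdP.≡-dec _≟A_ _≟B_ (x , y) (x₀ , y₀)) ((x ≟A x₀) ×-dec (y ≟B y₀))))
      (⟦⟧-× (x ≟A x₀) (y ≟B y₀))

  ∑-allFin-suc : ∀ {s} (f : Fin (suc s) → R) → ∑ (allFin (suc s)) f ≡ f zero + ∑[ i ∈ allFin s ] f (suc i)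
  ∑-allFin-suc {s} f = ≡.cong (f zero +_)
    (≡.trans (≡.cong (λ is → ∑ is f) (≡.sym (ListP.map-tabulate (λ i → i) suc))) (∑-map suc (allFin s) f))

  allFin-enumerates : ∀ s → Enumerates FinP._≟_ (allFin s)
  ∑-sift (allFin-enumerates (suc s)) zero g = begin
    ∑[ i ∈ allFin (suc s) ] (⟦ i FinP.≟ zero ⟧ * g i)           ≡⟨ ∑-allFin-suc (λ i → ⟦ i FinP.≟ zero ⟧ * g i) ⟩
    1# * g zero + ∑[ i ∈ allFin s ] (0# * g (suc i))
      ≈⟨ +-cong (*-identityˡ _) (trans (∑-cong (allFin s) (λ i → zeroˡ _)) (∑-0# (allFin s))) ⟩
    g zero + 0#                                                 ≈⟨ +-identityʳ _ ⟩
    g zero                                                      ∎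
  ∑-sift (allFin-enumerates (suc s)) (suc i₀) g = begin
    ∑[ i ∈ allFin (suc s) ] (⟦ i FinP.≟ suc i₀ ⟧ * g i)         ≡⟨ ∑-allFin-suc (λ i → ⟦ i FinP.≟ suc i₀ ⟧ * g i) ⟩
    0# * g zero + ∑[ i ∈ allFin s ] (⟦ suc i FinP.≟ suc i₀ ⟧ * g (suc i))
      ≈⟨ +-cong (zeroˡ _) (∑-cong (allFin s) (λ i → *-congʳ (reflexive
           (⟦⟧-cong (mk⇔ FinP.suc-injective (≡.cong suc)) (suc i FinP.≟ suc i₀) (i FinP.≟ i₀))))) ⟩
    0# + ∑[ i ∈ allFin s ] (⟦ i FinP.≟ i₀ ⟧ * g (suc i))        ≈⟨ +-identityˡ _ ⟩
    ∑[ i ∈ allFin s ] (⟦ i FinP.≟ i₀ ⟧ * g (suc i))             ≈⟨ ∑-sift (allFin-enumerates s) i₀ (g ∘ suc) ⟩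
    g (suc i₀)                                                  ∎

module ℕΣ = IndicatorSums NatP.+-*-commutativeSemiring

drop-length-++ : ∀ {a} {A : Set a} (u v : List A) → drop (length u) (u ++ v) ≡ v
drop-length-++ [] v = ≡.refl
drop-length-++ (x ∷ u) v = drop-length-++ u v

++≡⇔drop-length : ∀ {a} {A : Set a} (u v w : List A) →
                  (u ++ v ≡ w) ⇔ (v ≡ drop (length u) w × u ++ drop (length u) w ≡ w)
++≡⇔drop-length u v w = mk⇔
  (λ { ≡.refl → ≡.sym (drop-length-++ u v) , ≡.cong (u ++_) (drop-length-++ u v) })
  (λ { (≡.refl , eq) → eq })

Vec-map-injective : ∀ {a b} {A : Set a} {B : Set b} {f : A → B} → Injective _≡_ _≡_ f →
                    ∀ {n} {xs ys : Vec A n} → Vec.map f xs ≡ Vec.map f ys → xs ≡ ys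
Vec-map-injective f-inj {xs = []} {[]} _ = ≡.refl
Vec-map-injective f-inj {xs = x ∷ xs} {y ∷ ys} eq =
  ≡.cong₂ _∷_ (f-inj (VecP.∷-injectiveˡ eq)) (Vec-map-injective f-inj (VecP.∷-injectiveʳ eq))

Vec-map-preimage : ∀ {a b} {A : Set a} {B : Set b} (f : A → B) {n} (ys : Vec B n) →
                   (∀ i → Σ A (λ x → f x ≡ Vec.lookup ys i)) → Σ (Vec A n) (λ xs → Vec.map f xs ≡ ys)
Vec-map-preimage f [] _ = [] , ≡.refl
Vec-map-preimage f (y ∷ ys) pre with pre zero | Vec-map-preimage f ys (pre ∘ suc)
... | x , fx≡y | xs , ≡.refl = x ∷ xs , ≡.cong (_∷ Vec.map f xs) fx≡y

_≟V_ : ∀ {s n} → DecidableEquality (Vec (Fin s) n)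
_≟V_ = VecP.≡-dec FinP._≟_

_≟ℕs_ : ∀ {k} → DecidableEquality (Vec ℕ k)
_≟ℕs_ = VecP.≡-dec NatP._≟_

module FreeAlgebra {c ℓ : Level} (K : CommutativeRing c ℓ) (m : ℕ) where
  open CommutativeRing K renaming (Carrier to R) hiding (zero)
  open Model K m
  open IndicatorSums commutativeSemiring public
  open import Relation.Binary.Reasoning.Setoid setoid

  coeff-term : {B : Set} → DecidableEquality B → B → R × B → R
  coeff-term _≟_ b (r , b′) = r * ⟦ b′ ≟ b ⟧

  module _ {B : Set} (_≟_ : DecidableEquality B) where

    coeff≈∑ : (x : Lin B) (b : B) → coeff _≟_ x b ≈ ∑ x (coeff-term _≟_ b)
    coeff≈∑ [] b = refl
    coeff≈∑ ((r , b′) ∷ x) b = +-cong (if-does≈*⟦⟧ (b′ ≟ b) r) (coeff≈∑ x b)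

    coeff-++ : (x y : Lin B) (b : B) → coeff _≟_ (x ++ y) b ≈ coeff _≟_ x b + coeff _≟_ y b
    coeff-++ [] y b = sym (+-identityˡ _)
    coeff-++ ((r , b′) ∷ x) y b = trans (+-congˡ (coeff-++ x y b)) (sym (+-assoc _ _ _))

    coeff-concatMap : ∀ {a} {A : Set a} (f : A → Lin B) (xs : List A) (b : B) →
                      coeff _≟_ (List.concatMap f xs) b ≈ ∑[ x ∈ xs ] coeff _≟_ (f x) b
    coeff-concatMap f [] b = refl
    coeff-concatMap f (x ∷ xs) b = trans (coeff-++ (f x) _ b) (+-congˡ (coeff-concatMap f xs b))

  keepIf : ∀ {p} {P : Set p} {B : Set} → Dec P → Lin B → Lin B
  keepIf (yes _) x = x
  keepIf (no _) _ = []

  coeff-keepIf : ∀ {p} {P : Set p} {B : Set} (_≟_ : DecidableEquality B) (P? : Dec P) (x : Lin B) (b : B) →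
                 coeff _≟_ (keepIf P? x) b ≈ ⟦ P? ⟧ * coeff _≟_ x b
  coeff-keepIf _≟_ (yes _) x b = sym (*-identityˡ _)
  coeff-keepIf _≟_ (no _) x b = sym (zeroˡ _)

  coeff-• : ∀ {n} (r : R) (x : T n) (b : Basis n) → coeff _≟B_ (r •T x) b ≈ r * coeff _≟B_ x b
  coeff-• r [] b = sym (zeroʳ r)
  coeff-• r ((s , b′) ∷ x) b = begin
    (if does (b′ ≟B b) then r * s else 0#) + coeff _≟B_ (r •T x) b
      ≈⟨ +-cong (if-does≈*⟦⟧ (b′ ≟B b) (r * s)) (coeff-• r x b) ⟩
    (r * s) * ⟦ b′ ≟B b ⟧ + r * coeff _≟B_ x b
      ≈⟨ +-congʳ (trans (*-assoc r s _) (*-congˡ (sym (if-does≈*⟦⟧ (b′ ≟B b) s)))) ⟩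
    r * (if does (b′ ≟B b) then s else 0#) + r * coeff _≟B_ x b
      ≈⟨ distribˡ r _ _ ⟨
    r * coeff _≟B_ ((s , b′) ∷ x) b ∎

  _≈F_ : F → F → Set ℓ
  f ≈F g = ∀ w → coeff _≟W_ f w ≈ coeff _≟W_ g w

  1F : F
  1F = (1# , []) ∷ []

  ∑-·F : (f g : F) (Φ : R × Word → R) →
         ∑ (f ·F g) Φ ≈ ∑[ (r , u) ∈ f ] ∑[ (s , v) ∈ g ] Φ (r * s , u ++ v)
  ∑-·F f g Φ = trans (∑-concatMap _ f Φ) (∑-cong f (λ { (r , u) → reflexive (∑-map _ g Φ) }))

  coeff-·F : (f g : F) (w : Word) →
             coeff _≟W_ (f ·F g) w ≈ ∑[ (r , u) ∈ f ] ∑[ (s , v) ∈ g ] ((r * s) * ⟦ (u ++ v) ≟W w ⟧)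
  coeff-·F f g w = trans (coeff≈∑ _≟W_ (f ·F g) w) (∑-·F f g _)

  coeff-·F-suffix : (f g : F) (w : Word) → coeff _≟W_ (f ·F g) w ≈
    ∑[ (r , u) ∈ f ] (r * (coeff _≟W_ g (drop (length u) w) * ⟦ (u ++ drop (length u) w) ≟W w ⟧))
  coeff-·F-suffix f g w = trans (coeff-·F f g w) (∑-cong f λ { (r , u) → begin
      ∑[ (s , v) ∈ g ] ((r * s) * ⟦ (u ++ v) ≟W w ⟧)
        ≈⟨ ∑-cong g (λ { (s , v) → *-cong refl (split u v) }) ⟩
      ∑[ (s , v) ∈ g ] ((r * s) * (⟦ v ≟W suffix u ⟧ * ⟦ (u ++ suffix u) ≟W w ⟧))
        ≈⟨ ∑-cong g (λ { (s , v) → trans (*-assoc r s _) (*-congˡ (sym (*-assoc s _ _))) }) ⟩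
      ∑[ (s , v) ∈ g ] (r * ((s * ⟦ v ≟W suffix u ⟧) * ⟦ (u ++ suffix u) ≟W w ⟧))
        ≈⟨ ∑-*ˡ g r _ ⟨
      r * ∑[ (s , v) ∈ g ] ((s * ⟦ v ≟W suffix u ⟧) * ⟦ (u ++ suffix u) ≟W w ⟧)
        ≈⟨ *-congˡ (trans (sym (∑-*ʳ g _ _)) (*-congʳ (sym (coeff≈∑ _≟W_ g (suffix u))))) ⟩
      r * (coeff _≟W_ g (suffix u) * ⟦ (u ++ suffix u) ≟W w ⟧) ∎ })
    where
    suffix : Word → Word
    suffix u = drop (length u) w
    split : ∀ u v → ⟦ (u ++ v) ≟W w ⟧ ≈ ⟦ v ≟W suffix u ⟧ * ⟦ (u ++ suffix u) ≟W w ⟧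
    split u v = trans
      (reflexive (⟦⟧-cong (++≡⇔drop-length u v w) ((u ++ v) ≟W w) ((v ≟W suffix u) ×-dec ((u ++ suffix u) ≟W w))))
                      (⟦⟧-× (v ≟W suffix u) ((u ++ suffix u) ≟W w))

  ·F-congˡ : (f : F) {g g′ : F} → g ≈F g′ → (f ·F g) ≈F (f ·F g′)
  ·F-congˡ f {g} {g′} g≈g′ w = begin
    coeff _≟W_ (f ·F g) w    ≈⟨ coeff-·F-suffix f g w ⟩
    _                        ≈⟨ ∑-cong f (λ { (r , u) → *-congˡ (*-congʳ (g≈g′ (drop (length u) w))) }) ⟩
    _                        ≈⟨ coeff-·F-suffix f g′ w ⟨
    coeff _≟W_ (f ·F g′) w   ∎

  ·F-assoc : (f g h : F) → ((f ·F g) ·F h) ≈F (f ·F (g ·F h))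
  ·F-assoc f g h w = begin
    coeff _≟W_ ((f ·F g) ·F h) w
      ≈⟨ trans (coeff≈∑ _≟W_ ((f ·F g) ·F h) w) (trans (∑-·F (f ·F g) h _) (∑-·F f g _)) ⟩
    ∑[ (r , u) ∈ f ] ∑[ (s , v) ∈ g ] ∑[ (t , x) ∈ h ] (((r * s) * t) * ⟦ ((u ++ v) ++ x) ≟W w ⟧)
      ≈⟨ ∑-cong f (λ { (r , u) → ∑-cong g (λ { (s , v) → ∑-cong h (λ { (t , x) →
           *-cong (*-assoc r s t) (reflexive (≡.cong (λ z → ⟦ z ≟W w ⟧) (ListP.++-assoc u v x))) }) }) }) ⟩
    ∑[ (r , u) ∈ f ] ∑[ (s , v) ∈ g ] ∑[ (t , x) ∈ h ] ((r * (s * t)) * ⟦ (u ++ (v ++ x)) ≟W w ⟧)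
      ≈⟨ trans (∑-·F f (g ·F h) _) (∑-cong f (λ { (r , u) → ∑-·F g h _ })) ⟨
    ∑ (f ·F (g ·F h)) (coeff-term _≟W_ w)
      ≈⟨ coeff≈∑ _≟W_ (f ·F (g ·F h)) w ⟨
    coeff _≟W_ (f ·F (g ·F h)) w ∎

  ·F-identityˡ : (f : F) → (1F ·F f) ≈F f
  ·F-identityˡ f w = begin
    coeff _≟W_ (1F ·F f) w                               ≈⟨ coeff-·F 1F f w ⟩
    ∑[ (s , v) ∈ f ] ((1# * s) * ⟦ v ≟W w ⟧) + 0#       ≈⟨ +-identityʳ _ ⟩
    ∑[ (s , v) ∈ f ] ((1# * s) * ⟦ v ≟W w ⟧)            ≈⟨ ∑-cong f (λ { (s , v) → *-congʳ (*-identityˡ s) }) ⟩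
    ∑ f (coeff-term _≟W_ w)                               ≈⟨ coeff≈∑ _≟W_ f w ⟨
    coeff _≟W_ f w                                        ∎

  ·F-identityʳ : (f : F) → (f ·F 1F) ≈F f
  ·F-identityʳ f w = begin
    coeff _≟W_ (f ·F 1F) w                                   ≈⟨ coeff-·F f 1F w ⟩
    ∑[ (r , u) ∈ f ] ((r * 1#) * ⟦ (u ++ []) ≟W w ⟧ + 0#)
      ≈⟨ ∑-cong f (λ { (r , u) → trans (+-identityʳ _)
           (*-cong (*-identityʳ r) (reflexive (≡.cong (λ z → ⟦ z ≟W w ⟧) (ListP.++-identityʳ u)))) }) ⟩
    ∑ f (coeff-term _≟W_ w)                                   ≈⟨ coeff≈∑ _≟W_ f w ⟨
    coeff _≟W_ f w                                            ∎

  ∏coeff : ∀ {n} → Vec F n → Basis n → R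
  ∏coeff [] [] = 1#
  ∏coeff (f ∷ fs) (w ∷ ws) = coeff _≟W_ f w * ∏coeff fs ws

  _⊗∷_ : ∀ {n} → F → T n → T (suc n)
  f ⊗∷ x = List.concatMap (λ { (r , w) → List.map (λ { (s , ws) → (r * s , w ∷ ws) }) x }) f

  ∑-⊗∷ : ∀ {n} (f : F) (x : T n) (Φ : R × Basis (suc n) → R) →
         ∑ (f ⊗∷ x) Φ ≈ ∑[ (r , w) ∈ f ] ∑[ (s , ws) ∈ x ] Φ (r * s , w ∷ ws)
  ∑-⊗∷ f x Φ = trans (∑-concatMap _ f Φ) (∑-cong f (λ { (r , w) → reflexive (∑-map _ x Φ) }))

  ∑-·T : ∀ {n} (x y : T n) (Φ : R × Basis n → R) →
         ∑ (x ·T y) Φ ≈ ∑[ (r , u) ∈ x ] ∑[ (s , v) ∈ y ] Φ (r * s , Vec.zipWith _++_ u v)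
  ∑-·T x y Φ = trans (∑-concatMap _ x Φ) (∑-cong x (λ { (r , u) → reflexive (∑-map _ y Φ) }))

  coeff-·T : ∀ {n} (x y : T n) (w : Basis n) → coeff _≟B_ (x ·T y) w ≈
             ∑[ (r , u) ∈ x ] ∑[ (s , v) ∈ y ] ((r * s) * ⟦ Vec.zipWith _++_ u v ≟B w ⟧)
  coeff-·T x y w = trans (coeff≈∑ _≟B_ (x ·T y) w) (∑-·T x y _)

  coeff-⊗∷ : ∀ {n} (f : F) (x : T n) (w : Word) (ws : Basis n) →
             coeff _≟B_ (f ⊗∷ x) (w ∷ ws) ≈ coeff _≟W_ f w * coeff _≟B_ x ws
  coeff-⊗∷ f x w ws = begin
    coeff _≟B_ (f ⊗∷ x) (w ∷ ws)
      ≈⟨ trans (coeff≈∑ _≟B_ (f ⊗∷ x) (w ∷ ws)) (∑-⊗∷ f x _) ⟩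
    ∑[ (r , a) ∈ f ] ∑[ (s , as) ∈ x ] ((r * s) * ⟦ (a ∷ as) ≟B (w ∷ ws) ⟧)
      ≈⟨ ∑-cong f (λ { (r , a) → ∑-cong x (λ { (s , as) →
           trans (*-congˡ (⟦≡-dec-∷⟧ _≟W_ a w as ws)) (*-interchange r s _ _) }) }) ⟩
    ∑[ (r , a) ∈ f ] ∑[ (s , as) ∈ x ] ((r * ⟦ a ≟W w ⟧) * (s * ⟦ as ≟B ws ⟧))
      ≈⟨ ∑-*-∑ f x _ _ ⟨
    ∑ f (coeff-term _≟W_ w) * ∑ x (coeff-term _≟B_ ws)
      ≈⟨ *-cong (coeff≈∑ _≟W_ f w) (coeff≈∑ _≟B_ x ws) ⟨
    coeff _≟W_ f w * coeff _≟B_ x ws ∎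

  coeff-⊗ : ∀ {n} (fs : Vec F n) (w : Basis n) → coeff _≟B_ (⊗ fs) w ≈ ∏coeff fs w
  coeff-⊗ [] [] = +-identityʳ 1#
  coeff-⊗ (f ∷ fs) (w ∷ ws) = trans (coeff-⊗∷ f (⊗ fs) w ws) (*-congˡ (coeff-⊗ fs ws))

  coeff-⊗∷·⊗∷ : ∀ {n} (f g : F) (x y : T n) (w : Word) (ws : Basis n) →
                coeff _≟B_ ((f ⊗∷ x) ·T (g ⊗∷ y)) (w ∷ ws) ≈ coeff _≟W_ (f ·F g) w * coeff _≟B_ (x ·T y) ws
  coeff-⊗∷·⊗∷ f g x y w ws = begin
    coeff _≟B_ ((f ⊗∷ x) ·T (g ⊗∷ y)) (w ∷ ws)
      ≈⟨ trans (coeff-·T (f ⊗∷ x) (g ⊗∷ y) (w ∷ ws))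
               (trans (∑-⊗∷ f x _) (∑-cong f (λ { (r₁ , a) → ∑-cong x (λ { (r₂ , as) → ∑-⊗∷ g y _ }) }))) ⟩
    ∑[ (r₁ , a) ∈ f ] ∑[ (r₂ , as) ∈ x ] ∑[ (s₁ , b) ∈ g ] ∑[ (s₂ , bs) ∈ y ]
      (((r₁ * r₂) * (s₁ * s₂)) * ⟦ ((a ++ b) ∷ Vec.zipWith _++_ as bs) ≟B (w ∷ ws) ⟧)
      ≈⟨ ∑-cong f (λ { (r₁ , a) → ∑-cong x (λ { (r₂ , as) → ∑-cong g (λ { (s₁ , b) → ∑-cong y (λ { (s₂ , bs) →
           trans (*-cong (*-interchange r₁ r₂ s₁ s₂) (⟦≡-dec-∷⟧ _≟W_ (a ++ b) w _ ws)) (*-interchange _ _ _ _) }) }) }) }) ⟩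
    ∑[ (r₁ , a) ∈ f ] ∑[ (r₂ , as) ∈ x ] ∑[ (s₁ , b) ∈ g ] ∑[ (s₂ , bs) ∈ y ]
      (((r₁ * s₁) * ⟦ (a ++ b) ≟W w ⟧) * ((r₂ * s₂) * ⟦ Vec.zipWith _++_ as bs ≟B ws ⟧))
      ≈⟨ trans (∑-*-∑ f x _ _) (∑-cong f (λ { (r₁ , a) → ∑-cong x (λ { (r₂ , as) → ∑-*-∑ g y _ _ }) })) ⟨
    (∑[ (r₁ , a) ∈ f ] ∑[ (s₁ , b) ∈ g ] ((r₁ * s₁) * ⟦ (a ++ b) ≟W w ⟧)) *
      (∑[ (r₂ , as) ∈ x ] ∑[ (s₂ , bs) ∈ y ] ((r₂ * s₂) * ⟦ Vec.zipWith _++_ as bs ≟B ws ⟧))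
      ≈⟨ *-cong (coeff-·F f g w) (coeff-·T x y ws) ⟨
    coeff _≟W_ (f ·F g) w * coeff _≟B_ (x ·T y) ws ∎

  coeff-⊗·⊗ : ∀ {n} (fs gs : Vec F n) (w : Basis n) →
              coeff _≟B_ (⊗ fs ·T ⊗ gs) w ≈ ∏coeff (Vec.zipWith _·F_ fs gs) w
  coeff-⊗·⊗ [] [] [] = trans (+-identityʳ _) (*-identityˡ 1#)
  coeff-⊗·⊗ (f ∷ fs) (g ∷ gs) (w ∷ ws) =
    trans (coeff-⊗∷·⊗∷ f g (⊗ fs) (⊗ gs) w ws) (*-congˡ (coeff-⊗·⊗ fs gs ws))

  coeff-1T : ∀ {n} (w : Basis n) → coeff _≟B_ (1T {n}) w ≈ ∏coeff (Vec.replicate n 1F) w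
  coeff-1T {zero} [] = +-identityʳ 1#
  coeff-1T {suc n} (w ∷ ws) = begin
    coeff _≟B_ (1T {suc n}) (w ∷ ws)          ≈⟨ trans (coeff≈∑ _≟B_ (1T {suc n}) (w ∷ ws)) (+-identityʳ _) ⟩
    1# * ⟦ ([] ∷ Vec.replicate n []) ≟B (w ∷ ws) ⟧
      ≈⟨ trans (*-identityˡ _) (⟦≡-dec-∷⟧ _≟W_ [] w _ ws) ⟩
    ⟦ [] ≟W w ⟧ * ⟦ Vec.replicate n [] ≟B ws ⟧
      ≈⟨ *-cong (trans (+-identityʳ _) (*-identityˡ _)) (trans (+-identityʳ _) (*-identityˡ _)) ⟨
    (1# * ⟦ [] ≟W w ⟧ + 0#) * (1# * ⟦ Vec.replicate n [] ≟B ws ⟧ + 0#)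
      ≈⟨ *-cong (coeff≈∑ _≟W_ 1F w) (coeff≈∑ _≟B_ (1T {n}) ws) ⟨
    coeff _≟W_ 1F w * coeff _≟B_ (1T {n}) ws ≈⟨ *-congˡ (coeff-1T ws) ⟩
    ∏coeff (Vec.replicate (suc n) 1F) (w ∷ ws) ∎

module Counting {c ℓ : Level} (K : CommutativeRing c ℓ) (m : ℕ) where
  open Model K m using (count; exponents)

  count-∷ : ∀ {s n} (i x : Fin s) (xs : Vec (Fin s) n) → count i (x ∷ xs) ≡ ℕΣ.⟦ x FinP.≟ i ⟧ Nat.+ count i xs
  count-∷ i x xs with x FinP.≟ i
  ... | yes _ = ≡.refl
  ... | no _ = ≡.refl

  count≤length : ∀ {s n} (i : Fin s) (xs : Vec (Fin s) n) → count i xs Nat.≤ n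
  count≤length i [] = z≤n
  count≤length i (x ∷ xs) with x FinP.≟ i
  ... | yes _ = s≤s (count≤length i xs)
  ... | no _ = NatP.m≤n⇒m≤1+n (count≤length i xs)

  count≡0⇒∉ : ∀ {s n} (i : Fin s) (xs : Vec (Fin s) n) → count i xs ≡ 0 → ∀ p → Vec.lookup xs p ≢ i
  count≡0⇒∉ i (x ∷ xs) none p eq with x FinP.≟ i
  count≡0⇒∉ i (x ∷ xs) () p eq | yes _
  count≡0⇒∉ i (x ∷ xs) none zero eq | no x≢i = x≢i eq
  count≡0⇒∉ i (x ∷ xs) none (suc p) eq | no _ = count≡0⇒∉ i xs none p eq

  count-map-injective : ∀ {s t n} {f : Fin s → Fin t} → Injective _≡_ _≡_ f →
                        (i : Fin s) (xs : Vec (Fin s) n) → count (f i) (Vec.map f xs) ≡ count i xs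
  count-map-injective f-inj i [] = ≡.refl
  count-map-injective {f = f} f-inj i (x ∷ xs) with f x FinP.≟ f i | x FinP.≟ i
  ... | yes _ | yes _ = ≡.cong suc (count-map-injective f-inj i xs)
  ... | yes fx≡fi | no x≢i = ⊥-elim (x≢i (f-inj fx≡fi))
  ... | no fx≢fi | yes ≡.refl = ⊥-elim (fx≢fi ≡.refl)
  ... | no _ | no _ = count-map-injective f-inj i xs

  count-map-∉ : ∀ {s t n} (f : Fin s → Fin t) (j : Fin t) → (∀ i → f i ≢ j) →
                (xs : Vec (Fin s) n) → count j (Vec.map f xs) ≡ 0
  count-map-∉ f j ∉ [] = ≡.refl
  count-map-∉ f j ∉ (x ∷ xs) with f x FinP.≟ j
  ... | yes fx≡j = ⊥-elim (∉ x fx≡j)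
  ... | no _ = count-map-∉ f j ∉ xs

  lookup-exponents : ∀ {k n} (σ : Vec (Fin (suc k)) n) (h : Fin k) → Vec.lookup (exponents σ) h ≡ count (suc h) σ
  lookup-exponents σ h = VecP.lookup∘tabulate (λ h → count (suc h) σ) h

  open ≡.≡-Reasoning

  module Restriction {k k′ : ℕ} (ρ : Fin k′ → Fin k) (ρ-injective : Injective _≡_ _≡_ ρ)
                     (β : Vec ℕ k) (β′ : Vec ℕ k′) (β∘ρ≡β′ : ∀ h → Vec.lookup β (ρ h) ≡ Vec.lookup β′ h)
                     (outside-zero : ∀ h → Σ (Fin k′) (λ h′ → ρ h′ ≡ h) ⊎ ((∀ h′ → ρ h′ ≢ h) × Vec.lookup β h ≡ 0)) where

    ι : Fin (suc k′) → Fin (suc k)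
    ι = Fin.lift 1 ρ

    ι-injective : Injective _≡_ _≡_ ι
    ι-injective = FinP.lift-injective ρ ρ-injective 1

    exponents-map-ι : ∀ {n} (σ : Vec (Fin (suc k′)) n) → exponents (Vec.map ι σ) ≡ β ⇔ exponents σ ≡ β′
    exponents-map-ι σ = mk⇔ to from
      where
      to : exponents (Vec.map ι σ) ≡ β → exponents σ ≡ β′
      to eq = Pointwise-≡⇒≡ (ext λ h → begin
        Vec.lookup (exponents σ) h               ≡⟨ lookup-exponents σ h ⟩
        count (suc h) σ                          ≡⟨ count-map-injective ι-injective (suc h) σ ⟨
        count (suc (ρ h)) (Vec.map ι σ)          ≡⟨ lookup-exponents (Vec.map ι σ) (ρ h) ⟨
        Vec.lookup (exponents (Vec.map ι σ)) (ρ h) ≡⟨ ≡.cong (λ κ → Vec.lookup κ (ρ h)) eq ⟩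
        Vec.lookup β (ρ h)                       ≡⟨ β∘ρ≡β′ h ⟩
        Vec.lookup β′ h                          ∎)
      from : exponents σ ≡ β′ → exponents (Vec.map ι σ) ≡ β
      from eq = Pointwise-≡⇒≡ (ext λ h → ≡.trans (lookup-exponents (Vec.map ι σ) h) (count-at h (outside-zero h)))
        where
        count-at : ∀ h → Σ (Fin k′) (λ h′ → ρ h′ ≡ h) ⊎ ((∀ h′ → ρ h′ ≢ h) × Vec.lookup β h ≡ 0) →
                   count (suc h) (Vec.map ι σ) ≡ Vec.lookup β h
        count-at _ (inj₁ (h′ , ≡.refl)) = begin
          count (suc (ρ h′)) (Vec.map ι σ)   ≡⟨ count-map-injective ι-injective (suc h′) σ ⟩
          count (suc h′) σ                   ≡⟨ lookup-exponents σ h′ ⟨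
          Vec.lookup (exponents σ) h′        ≡⟨ ≡.cong (λ κ → Vec.lookup κ h′) eq ⟩
          Vec.lookup β′ h′                   ≡⟨ β∘ρ≡β′ h′ ⟨
          Vec.lookup β (ρ h′)                ∎
        count-at h (inj₂ (∉ρ , βh≡0)) = ≡.trans (count-map-∉ ι (suc h) ∉ι σ) (≡.sym βh≡0)
          where
          ∉ι : ∀ i → ι i ≢ suc h
          ∉ι (suc h′) eq = ∉ρ h′ (FinP.suc-injective eq)

    map-ι-covers : ∀ {n} (τ : Vec (Fin (suc k)) n) → exponents τ ≡ β → Σ (Vec (Fin (suc k′)) n) (λ σ → Vec.map ι σ ≡ τ)
    map-ι-covers τ eq = Vec-map-preimage ι τ letter-preimage
      where
      letter-preimage : ∀ p → Σ (Fin (suc k′)) (λ y → ι y ≡ Vec.lookup τ p)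
      letter-preimage p with Vec.lookup τ p in τp≡
      ... | zero = zero , ≡.refl
      ... | suc h with outside-zero h
      ...   | inj₁ (h′ , ρh′≡h) = suc h′ , ≡.cong suc ρh′≡h
      ...   | inj₂ (_ , βh≡0) = ⊥-elim (count≡0⇒∉ (suc h) τ count≡0 p τp≡)
        where
        count≡0 : count (suc h) τ ≡ 0
        count≡0 = ≡.trans (≡.sym (lookup-exponents τ h)) (≡.trans (≡.cong (λ κ → Vec.lookup κ h) eq) βh≡0)

module Elementary {c ℓ : Level} (K : CommutativeRing c ℓ) (m : ℕ) where
  open CommutativeRing K renaming (Carrier to R) hiding (zero)
  open Model K m
  open FreeAlgebra K m
  open Counting K m
  open import Relation.Binary.Reasoning.Setoid setoid

  allVecs-enumerates : ∀ s n → Enumerates _≟V_ (allVecs s n)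
  ∑-sift (allVecs-enumerates s zero) [] g = trans (+-identityʳ _) (*-identityˡ _)
  ∑-sift (allVecs-enumerates s (suc n)) (i₀ ∷ σ₀) g = begin
    ∑[ σ ∈ allVecs s (suc n) ] (⟦ σ ≟V (i₀ ∷ σ₀) ⟧ * g σ)
      ≈⟨ ∑-concatMap _ (allFin s) _ ⟩
    ∑[ i ∈ allFin s ] ∑[ σ ∈ List.map (i ∷_) (allVecs s n) ] (⟦ σ ≟V (i₀ ∷ σ₀) ⟧ * g σ)
      ≈⟨ ∑-cong (allFin s) (λ i → reflexive (∑-map (i ∷_) (allVecs s n) _)) ⟩
    ∑[ i ∈ allFin s ] ∑[ σ ∈ allVecs s n ] (⟦ (i ∷ σ) ≟V (i₀ ∷ σ₀) ⟧ * g (i ∷ σ))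
      ≈⟨ ∑-cong (allFin s) (λ i → ∑-cong (allVecs s n) (λ σ →
           trans (*-congʳ (⟦≡-dec-∷⟧ FinP._≟_ i i₀ σ σ₀)) (*-assoc _ _ _))) ⟩
    ∑[ i ∈ allFin s ] ∑[ σ ∈ allVecs s n ] (⟦ i FinP.≟ i₀ ⟧ * (⟦ σ ≟V σ₀ ⟧ * g (i ∷ σ)))
      ≈⟨ ∑-cong (allFin s) (λ i → trans (sym (∑-*ˡ (allVecs s n) _ _))
           (*-congˡ (∑-sift (allVecs-enumerates s n) σ₀ (λ σ → g (i ∷ σ))))) ⟩
    ∑[ i ∈ allFin s ] (⟦ i FinP.≟ i₀ ⟧ * g (i ∷ σ₀))
      ≈⟨ ∑-sift (allFin-enumerates s) i₀ (λ i → g (i ∷ σ₀)) ⟩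
    g (i₀ ∷ σ₀) ∎

  boundedVecs : (n k : ℕ) → List (Vec ℕ k)
  boundedVecs n k = List.map (Vec.map toℕ) (allVecs (suc n) k)

  boundedVecs-sift : ∀ {n k} (κ₀ : Vec ℕ k) → (∀ i → Vec.lookup κ₀ i Nat.≤ n) → (g : Vec ℕ k → R) →
                     ∑[ κ ∈ boundedVecs n k ] (⟦ κ ≟ℕs κ₀ ⟧ * g κ) ≈ g κ₀
  boundedVecs-sift {n} {k} κ₀ κ₀≤n g with Vec-map-preimage toℕ κ₀ (λ i → Fin.fromℕ< (s≤s (κ₀≤n i)) , FinP.toℕ-fromℕ< _)
  ... | v₀ , ≡.refl = begin
    ∑[ κ ∈ boundedVecs n k ] (⟦ κ ≟ℕs Vec.map toℕ v₀ ⟧ * g κ)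
      ≡⟨ ∑-map _ (allVecs (suc n) k) _ ⟩
    ∑[ v ∈ allVecs (suc n) k ] (⟦ Vec.map toℕ v ≟ℕs Vec.map toℕ v₀ ⟧ * g (Vec.map toℕ v))
      ≈⟨ ∑-cong (allVecs (suc n) k) (λ v → *-congʳ (reflexive (⟦⟧-cong
           (mk⇔ (Vec-map-injective FinP.toℕ-injective) (≡.cong (Vec.map toℕ)))
           (Vec.map toℕ v ≟ℕs Vec.map toℕ v₀) (v ≟V v₀)))) ⟩
    ∑[ v ∈ allVecs (suc n) k ] (⟦ v ≟V v₀ ⟧ * g (Vec.map toℕ v))
      ≈⟨ ∑-sift (allVecs-enumerates (suc n) k) v₀ _ ⟩
    g (Vec.map toℕ v₀) ∎

  chosen : ∀ {k n} → Vec F k → Vec (Fin (suc k)) n → Vec F n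
  chosen b σ = Vec.map (choose b) σ

  ∑-e : ∀ n {k} (b : Vec F k) (β : Vec ℕ k) (Φ : R × Basis n → R) →
        ∑ (e n b β) Φ ≈ ∑[ σ ∈ allVecs (suc k) n ] (⟦ exponents σ ≟ℕs β ⟧ * ∑ (⊗ (chosen b σ)) Φ)
  ∑-e n {k} b β Φ = trans (∑-concatMap _ (List.filter (λ σ → exponents σ ≟ℕs β) (allVecs (suc k) n)) Φ)
                          (∑-filter (λ σ → exponents σ ≟ℕs β) (allVecs (suc k) n) _)

  coeff-e : ∀ n {k} (b : Vec F k) (β : Vec ℕ k) (w : Basis n) →
            coeff _≟B_ (e n b β) w ≈ ∑[ σ ∈ allVecs (suc k) n ] (⟦ exponents σ ≟ℕs β ⟧ * ∏coeff (chosen b σ) w)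
  coeff-e n {k} b β w = trans (coeff≈∑ _≟B_ (e n b β) w) (trans (∑-e n b β _)
    (∑-cong (allVecs (suc k) n) (λ σ → *-congˡ (trans (sym (coeff≈∑ _≟B_ (⊗ (chosen b σ)) w)) (coeff-⊗ (chosen b σ) w)))))

  ∏coeff-map-cong : ∀ {a} {A : Set a} {f g : A → F} → (∀ x → f x ≈F g x) →
                    ∀ {n} (σ : Vec A n) (w : Basis n) → ∏coeff (Vec.map f σ) w ≈ ∏coeff (Vec.map g σ) w
  ∏coeff-map-cong f≈g [] [] = refl
  ∏coeff-map-cong f≈g (x ∷ σ) (w ∷ ws) = *-cong (f≈g x w) (∏coeff-map-cong f≈g σ ws)

  choose-cong : ∀ {k} {b b′ : Vec F k} → (∀ h → Vec.lookup b h ≈F Vec.lookup b′ h) → ∀ i → choose b i ≈F choose b′ i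
  choose-cong b≈b′ zero w = refl
  choose-cong b≈b′ (suc h) = b≈b′ h

  e-cong : ∀ n {k} {b b′ : Vec F k} (β : Vec ℕ k) → (∀ h → Vec.lookup b h ≈F Vec.lookup b′ h) → e n b β ≈T e n b′ β
  e-cong n {k} {b} {b′} β b≈b′ w = begin
    coeff _≟B_ (e n b β) w    ≈⟨ coeff-e n b β w ⟩
    _                         ≈⟨ ∑-cong (allVecs (suc k) n) (λ σ → *-congˡ (∏coeff-map-cong (choose-cong b≈b′) σ w)) ⟩
    _                         ≈⟨ coeff-e n b′ β w ⟨
    coeff _≟B_ (e n b′ β) w   ∎

  e-empty : ∀ n → e n [] [] ≈T 1T {n}
  e-empty n w = begin
    coeff _≟B_ (e n [] []) w
      ≈⟨ coeff-e n [] [] w ⟩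
    ∑[ τ ∈ allVecs 1 n ] (1# * ∏coeff (chosen [] τ) w)
      ≈⟨ ∑-cong (allVecs 1 n) (λ τ → *-congʳ (reflexive (≡.sym (⟦⟧-yes (τ ≟V zeros) (all-zero τ))))) ⟩
    ∑[ τ ∈ allVecs 1 n ] (⟦ τ ≟V zeros ⟧ * ∏coeff (chosen [] τ) w)
      ≈⟨ ∑-sift (allVecs-enumerates 1 n) zeros _ ⟩
    ∏coeff (chosen [] zeros) w
      ≡⟨ ≡.cong (λ fs → ∏coeff fs w) (VecP.map-replicate (choose []) zero n) ⟩
    ∏coeff (Vec.replicate n 1F) w
      ≈⟨ coeff-1T w ⟨
    coeff _≟B_ (1T {n}) w ∎
    where
    zeros : Vec (Fin 1) n
    zeros = Vec.replicate n zero
    all-zero : ∀ {n′} (τ : Vec (Fin 1) n′) → τ ≡ Vec.replicate n′ zero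
    all-zero [] = ≡.refl
    all-zero (zero ∷ τ) = ≡.cong (zero ∷_) (all-zero τ)


  e-restrict : ∀ n {k k′} (ρ : Fin k′ → Fin k) (ρ-injective : Injective _≡_ _≡_ ρ) {b : Vec F k} {b′ : Vec F k′}
               (β : Vec ℕ k) (β′ : Vec ℕ k′) → (∀ h → Vec.lookup b (ρ h) ≈F Vec.lookup b′ h) →
               (β∘ρ≡β′ : ∀ h → Vec.lookup β (ρ h) ≡ Vec.lookup β′ h) →
               (outside-zero : ∀ h → Σ (Fin k′) (λ h′ → ρ h′ ≡ h) ⊎ ((∀ h′ → ρ h′ ≢ h) × Vec.lookup β h ≡ 0)) →
               e n b β ≈T e n b′ β′
  e-restrict n {k} {k′} ρ ρ-injective {b} {b′} β β′ b∘ρ≈b′ β∘ρ≡β′ outside-zero w = begin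
    coeff _≟B_ (e n b β) w
      ≈⟨ coeff-e n b β w ⟩
    ∑ (allVecs (suc k) n) summand
      ≈⟨ ∑-reindex (allVecs-enumerates _ n) (allVecs-enumerates _ n)
                   (Vec.map ι) (Vec-map-injective ι-injective) summand covers ⟩
    ∑[ σ ∈ allVecs (suc k′) n ] summand (Vec.map ι σ)
      ≈⟨ ∑-cong (allVecs (suc k′) n) (λ σ →
           *-cong (reflexive (⟦⟧-cong (exponents-map-ι σ) (exponents (Vec.map ι σ) ≟ℕs β) (exponents σ ≟ℕs β′)))
                  (chosen-map-ι σ)) ⟩
    ∑[ σ ∈ allVecs (suc k′) n ] (⟦ exponents σ ≟ℕs β′ ⟧ * ∏coeff (chosen b′ σ) w)
      ≈⟨ coeff-e n b′ β′ w ⟨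
    coeff _≟B_ (e n b′ β′) w ∎
    where
    open Restriction ρ ρ-injective β β′ β∘ρ≡β′ outside-zero
    summand : Vec (Fin (suc k)) n → R
    summand τ = ⟦ exponents τ ≟ℕs β ⟧ * ∏coeff (chosen b τ) w
    covers : ∀ τ → Σ _ (λ σ → Vec.map ι σ ≡ τ) ⊎ summand τ ≈ 0#
    covers τ with exponents τ ≟ℕs β
    ... | yes eq = inj₁ (map-ι-covers τ eq)
    ... | no _ = inj₂ (zeroˡ _)
    choose∘ι : ∀ i → choose b (ι i) ≈F choose b′ i
    choose∘ι zero w′ = refl
    choose∘ι (suc h) = b∘ρ≈b′ h
    chosen-map-ι : ∀ σ → ∏coeff (chosen b (Vec.map ι σ)) w ≈ ∏coeff (chosen b′ σ) w
    chosen-map-ι σ = trans (reflexive (≡.cong (λ fs → ∏coeff fs w) (≡.sym (VecP.map-∘ (choose b) ι σ))))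
                           (∏coeff-map-cong choose∘ι σ w)

  e-∷-zero : ∀ n {k} (g : F) (b : Vec F k) (β : Vec ℕ k) → e n (g ∷ b) (0 ∷ β) ≈T e n b β
  e-∷-zero n g b β = e-restrict n suc FinP.suc-injective (0 ∷ β) β (λ h w → refl) (λ h → ≡.refl) outside-zero
    where
    outside-zero : ∀ h → Σ (Fin _) (λ h′ → suc h′ ≡ h) ⊎ ((∀ h′ → suc h′ ≢ h) × Vec.lookup (0 ∷ β) h ≡ 0)
    outside-zero zero = inj₂ ((λ _ ()) , ≡.refl)
    outside-zero (suc h) = inj₁ (h , ≡.refl)

module _ where
  open Nat using (_+_)
  open ≡.≡-Reasoning

  ∑-allFin-lookup : ∀ {k} (xs : Vec ℕ k) → ℕΣ.∑ (allFin k) (Vec.lookup xs) ≡ sumℕ xs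
  ∑-allFin-lookup [] = ≡.refl
  ∑-allFin-lookup (x ∷ xs) = ≡.trans (ℕΣ.∑-allFin-suc (Vec.lookup (x ∷ xs))) (≡.cong (x +_) (∑-allFin-lookup xs))

  sumℕ-zipWith-+ : ∀ {k} (xs ys : Vec ℕ k) → sumℕ (Vec.zipWith _+_ xs ys) ≡ sumℕ xs + sumℕ ys
  sumℕ-zipWith-+ [] [] = ≡.refl
  sumℕ-zipWith-+ (x ∷ xs) (y ∷ ys) = ≡.trans (≡.cong (x + y +_) (sumℕ-zipWith-+ xs ys))
    (CommSemigroupProps.interchange NatP.+-commutativeSemigroup x y (sumℕ xs) (sumℕ ys))

  sumℕ≡0⇒≡replicate : ∀ {k} (xs : Vec ℕ k) → sumℕ xs ≡ 0 → xs ≡ Vec.replicate k 0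
  sumℕ≡0⇒≡replicate [] _ = ≡.refl
  sumℕ≡0⇒≡replicate (x ∷ xs) eq =
    ≡.cong₂ Vec._∷_ (NatP.m+n≡0⇒m≡0 x eq) (sumℕ≡0⇒≡replicate xs (NatP.m+n≡0⇒n≡0 x eq))

  sumℕ-replicate-0 : ∀ k → sumℕ (Vec.replicate k 0) ≡ 0
  sumℕ-replicate-0 zero = ≡.refl
  sumℕ-replicate-0 (suc k) = sumℕ-replicate-0 k

  lookup≤sumℕ : ∀ {k} (xs : Vec ℕ k) i → Vec.lookup xs i Nat.≤ sumℕ xs
  lookup≤sumℕ (x ∷ xs) zero = NatP.m≤m+n x _
  lookup≤sumℕ (x ∷ xs) (suc i) = NatP.≤-trans (lookup≤sumℕ xs i) (NatP.m≤n+m _ x)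

  zipWith-+-replicate-0 : ∀ {k} (xs : Vec ℕ k) → Vec.zipWith _+_ xs (Vec.replicate k 0) ≡ xs
  zipWith-+-replicate-0 [] = ≡.refl
  zipWith-+-replicate-0 (x ∷ xs) = ≡.cong₂ Vec._∷_ (NatP.+-identityʳ x) (zipWith-+-replicate-0 xs)

  split-exponent-leading-or-smaller : ∀ {k j} {β : Vec ℕ k} x (xs ys : Vec ℕ k) →
    x + sumℕ ys ≡ j → Vec.zipWith _+_ xs ys ≡ β →
    x Vec.∷ (xs Vec.++ ys) ≡ j ∷ (β Vec.++ Vec.replicate k 0) ⊎ sumℕ (x ∷ (xs Vec.++ ys)) Nat.< j + sumℕ β
  split-exponent-leading-or-smaller {k} x xs ys ≡.refl ≡.refl with sumℕ ys in sy≡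
  ... | zero = inj₁ (≡.cong₂ Vec._∷_ (≡.sym (NatP.+-identityʳ x))
          (≡.cong₂ Vec._++_ (≡.sym (≡.trans (≡.cong (Vec.zipWith _+_ xs) ys≡0) (zipWith-+-replicate-0 xs))) ys≡0))
    where
    ys≡0 : ys ≡ Vec.replicate k 0
    ys≡0 = sumℕ≡0⇒≡replicate ys sy≡
  ... | suc t = inj₂ (≡.subst₂ Nat._<_ (≡.sym lhs) (≡.sym rhs) (NatP.m<n+m (x + (sumℕ xs + suc t)) {suc t} (s≤s z≤n)))
    where
    lhs : sumℕ (x ∷ (xs Vec.++ ys)) ≡ x + (sumℕ xs + suc t)
    lhs = ≡.cong (x +_) (≡.trans (VecP.sum-++ xs) (≡.cong (sumℕ xs +_) sy≡))
    rhs : x + suc t + sumℕ (Vec.zipWith _+_ xs ys) ≡ suc t + (x + (sumℕ xs + suc t))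
    rhs = begin
      x + suc t + sumℕ (Vec.zipWith _+_ xs ys)
        ≡⟨ ≡.cong (x + suc t +_) (≡.trans (sumℕ-zipWith-+ xs ys) (≡.cong (sumℕ xs +_) sy≡)) ⟩
      x + suc t + (sumℕ xs + suc t)              ≡⟨ ≡.cong (_+ (sumℕ xs + suc t)) (NatP.+-comm x (suc t)) ⟩
      suc t + x + (sumℕ xs + suc t)              ≡⟨ NatP.+-assoc (suc t) x _ ⟩
      suc t + (x + (sumℕ xs + suc t))            ∎


-- The product formula has the 2k + 1 variables g , b₁ … b_k , g b₁ … g b_k (see merged): gVar i is the
-- position of g · choose b i and bVar h that of b_h.  Letter merge s i of a merged word stands for the
-- factor choose (g ∷ []) s ·F choose b i.
module Merge (k : ℕ) where
  open Nat using (_+_)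
  open ℕΣ using (∑; ∑-cong; ∑-allFin-suc)
  open ≡.≡-Reasoning

  gVar : Fin (suc k) → Fin (suc (k + k))
  gVar zero = zero
  gVar (suc h) = suc (k ↑ʳ h)

  bVar : Fin k → Fin (suc (k + k))
  bVar h = suc (h ↑ˡ k)

  merge : Fin 2 → Fin (suc k) → Fin (suc (suc (k + k)))
  merge zero zero = zero
  merge zero (suc h) = suc (bVar h)
  merge (suc zero) i = suc (gVar i)

  unmerge : Fin (suc (suc (k + k))) → Fin 2 × Fin (suc k)
  unmerge zero = zero , zero
  unmerge (suc zero) = suc zero , zero
  unmerge (suc (suc l)) = [ (λ h → zero , suc h) , (λ h → suc zero , suc h) ]′ (Fin.splitAt k l)

  unmerge-merge : ∀ s i → unmerge (merge s i) ≡ (s , i)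
  unmerge-merge zero zero = ≡.refl
  unmerge-merge zero (suc h) = ≡.cong [ _ , _ ]′ (FinP.splitAt-↑ˡ k h k)
  unmerge-merge (suc zero) zero = ≡.refl
  unmerge-merge (suc zero) (suc h) = ≡.cong [ _ , _ ]′ (FinP.splitAt-↑ʳ k k h)

  merge-unmerge : ∀ l → uncurry merge (unmerge l) ≡ l
  merge-unmerge zero = ≡.refl
  merge-unmerge (suc zero) = ≡.refl
  merge-unmerge (suc (suc l)) with Fin.splitAt k l in eq
  ... | inj₁ h = ≡.cong (λ l → suc (suc l)) (FinP.splitAt⁻¹-↑ˡ eq)
  ... | inj₂ h = ≡.cong (λ l → suc (suc l)) (FinP.splitAt⁻¹-↑ʳ eq)

  merge≡merge⇔ : ∀ {s i s′ i′} → merge s i ≡ merge s′ i′ ⇔ (s ≡ s′ × i ≡ i′)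
  merge≡merge⇔ {s} {i} {s′} {i′} = mk⇔
    (λ eq → ProdP.,-injective (≡.trans (≡.sym (unmerge-merge s i)) (≡.trans (≡.cong unmerge eq) (unmerge-merge s′ i′))))
    (λ { (≡.refl , ≡.refl) → ≡.refl })

  gDegree : Vec ℕ (suc (k + k)) → ℕ
  gDegree κ = ∑[ i ∈ allFin (suc k) ] Vec.lookup κ (gVar i)

  bDegrees : Vec ℕ (suc (k + k)) → Vec ℕ k
  bDegrees κ = Vec.tabulate (λ h → Vec.lookup κ (bVar h) + Vec.lookup κ (gVar (suc h)))

  gDegree-split : ∀ x (xs ys : Vec ℕ k) → gDegree (x ∷ (xs Vec.++ ys)) ≡ x + sumℕ ys
  gDegree-split x xs ys = begin
    gDegree (x ∷ (xs Vec.++ ys))                               ≡⟨ ∑-allFin-suc (Vec.lookup (x ∷ (xs Vec.++ ys)) ∘ gVar) ⟩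
    x + ∑[ h ∈ allFin k ] Vec.lookup (xs Vec.++ ys) (k ↑ʳ h)  ≡⟨ ≡.cong (x +_) (∑-cong (allFin k) (VecP.lookup-++ʳ xs ys)) ⟩
    x + ∑ (allFin k) (Vec.lookup ys)                        ≡⟨ ≡.cong (x +_) (∑-allFin-lookup ys) ⟩
    x + sumℕ ys                                                ∎

  bDegrees-split : ∀ x (xs ys : Vec ℕ k) → bDegrees (x ∷ (xs Vec.++ ys)) ≡ Vec.zipWith _+_ xs ys
  bDegrees-split x xs ys = Pointwise-≡⇒≡ (ext λ h → begin
    Vec.lookup (bDegrees (x ∷ (xs Vec.++ ys))) h
      ≡⟨ VecP.lookup∘tabulate _ h ⟩
    Vec.lookup (xs Vec.++ ys) (h ↑ˡ k) + Vec.lookup (xs Vec.++ ys) (k ↑ʳ h)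
      ≡⟨ ≡.cong₂ _+_ (VecP.lookup-++ˡ xs ys h) (VecP.lookup-++ʳ xs ys h) ⟩
    Vec.lookup xs h + Vec.lookup ys h
      ≡⟨ VecP.lookup-zipWith _+_ h xs ys ⟨
    Vec.lookup (Vec.zipWith _+_ xs ys) h ∎)

  module Leading (j : ℕ) (β : Vec ℕ k) where

    MergedExponent : Vec ℕ (suc (k + k)) → Set
    MergedExponent κ = gDegree κ ≡ j × bDegrees κ ≡ β

    mergedExponent? : ∀ κ → Dec (MergedExponent κ)
    mergedExponent? κ = (gDegree κ NatP.≟ j) ×-dec (bDegrees κ ≟ℕs β)

    leading : Vec ℕ (suc (k + k))
    leading = j ∷ (β Vec.++ Vec.replicate k 0)

    leading-merged : MergedExponent leading
    leading-merged =
      ≡.trans (gDegree-split j β _) (≡.trans (≡.cong (j +_) (sumℕ-replicate-0 k)) (NatP.+-identityʳ j)) ,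
      ≡.trans (bDegrees-split j β _) (zipWith-+-replicate-0 β)

    sumℕ-leading : sumℕ leading ≡ j + sumℕ β
    sumℕ-leading = ≡.cong (j +_)
      (≡.trans (VecP.sum-++ β) (≡.trans (≡.cong (sumℕ β +_) (sumℕ-replicate-0 k)) (NatP.+-identityʳ _)))

    smaller-unless-leading : ∀ κ → MergedExponent κ → κ ≢ leading → sumℕ κ Nat.< j + sumℕ β
    smaller-unless-leading (x ∷ rest) (gκ≡j , bκ≡β) κ≢leading with Vec.splitAt k rest
    ... | xs , ys , ≡.refl = [ ⊥-elim ∘ κ≢leading , (λ κ< → κ<) ]′ (split-exponent-leading-or-smaller x xs ys
            (≡.trans (≡.sym (gDegree-split x xs ys)) gκ≡j) (≡.trans (≡.sym (bDegrees-split x xs ys)) bκ≡β))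

module MergeCounting {c ℓ : Level} (K : CommutativeRing c ℓ) (m k : ℕ) where
  open Model K m using (count; exponents)
  open Counting K m
  open Merge k
  open Nat using (_+_; _*_)
  open ℕΣ using (⟦_⟧; ∑; ∑-cong; ∑-+; ∑-*ˡ; ∑-0#; ∑-sift; allFin-enumerates; ⟦⟧-cong; ⟦⟧-×)
  open FinP using (_≟_)
  open ≡.≡-Reasoning

  ⟦merge≟merge⟧ : ∀ s i s′ i′ → ⟦ merge s i ≟ merge s′ i′ ⟧ ≡ ⟦ s ≟ s′ ⟧ * ⟦ i ≟ i′ ⟧
  ⟦merge≟merge⟧ s i s′ i′ =
    ≡.trans (⟦⟧-cong merge≡merge⇔ (merge s i ≟ merge s′ i′) ((s ≟ s′) ×-dec (i ≟ i′))) (⟦⟧-× (s ≟ s′) (i ≟ i′))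

  row-sum : ∀ s i s₀ → ∑[ i′ ∈ allFin (suc k) ] ⟦ merge s i ≟ merge s₀ i′ ⟧ ≡ ⟦ s ≟ s₀ ⟧
  row-sum s i s₀ = begin
    ∑[ i′ ∈ allFin (suc k) ] ⟦ merge s i ≟ merge s₀ i′ ⟧
      ≡⟨ ∑-cong (allFin (suc k)) (λ i′ → ≡.trans (⟦merge≟merge⟧ s i s₀ i′)
           (≡.cong (⟦ s ≟ s₀ ⟧ *_) (≡.trans (⟦⟧-cong (mk⇔ ≡.sym ≡.sym) (i ≟ i′) (i′ ≟ i))
             (≡.sym (NatP.*-identityʳ _))))) ⟩
    ∑[ i′ ∈ allFin (suc k) ] (⟦ s ≟ s₀ ⟧ * (⟦ i′ ≟ i ⟧ * 1))
      ≡⟨ ∑-*ˡ (allFin (suc k)) ⟦ s ≟ s₀ ⟧ (λ i′ → ⟦ i′ ≟ i ⟧ * 1) ⟨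
    ⟦ s ≟ s₀ ⟧ * ∑[ i′ ∈ allFin (suc k) ] (⟦ i′ ≟ i ⟧ * 1)
      ≡⟨ ≡.cong (⟦ s ≟ s₀ ⟧ *_) (∑-sift (allFin-enumerates (suc k)) i (λ _ → 1)) ⟩
    ⟦ s ≟ s₀ ⟧ * 1
      ≡⟨ NatP.*-identityʳ _ ⟩
    ⟦ s ≟ s₀ ⟧ ∎

  column-sum : ∀ s i i₀ → ⟦ merge s i ≟ merge zero i₀ ⟧ + ⟦ merge s i ≟ merge (suc zero) i₀ ⟧
                          ≡ ⟦ i ≟ i₀ ⟧
  column-sum s i i₀ = ≡.trans (≡.cong₂ _+_ (⟦merge≟merge⟧ s i zero i₀) (⟦merge≟merge⟧ s i (suc zero) i₀)) (by-row s)
    where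
    by-row : ∀ s → ⟦ s ≟ zero ⟧ * ⟦ i ≟ i₀ ⟧ + ⟦ s ≟ suc zero ⟧ * ⟦ i ≟ i₀ ⟧
                   ≡ ⟦ i ≟ i₀ ⟧
    by-row zero = ≡.trans (NatP.+-identityʳ _) (NatP.*-identityˡ _)
    by-row (suc zero) = NatP.*-identityˡ _

  count-merge-rows : ∀ {n} s₀ (S : Vec (Fin 2) n) (σ : Vec (Fin (suc k)) n) →
                     ∑[ i ∈ allFin (suc k) ] count (merge s₀ i) (Vec.zipWith merge S σ) ≡ count s₀ S
  count-merge-rows s₀ [] [] = ∑-0# (allFin (suc k))
  count-merge-rows s₀ (s ∷ S) (i ∷ σ) = begin
    ∑[ i′ ∈ allFin (suc k) ] count (merge s₀ i′) (merge s i ∷ τ)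
      ≡⟨ ∑-cong (allFin (suc k)) (λ i′ → count-∷ (merge s₀ i′) (merge s i) τ) ⟩
    ∑[ i′ ∈ allFin (suc k) ] (⟦ merge s i ≟ merge s₀ i′ ⟧ + count (merge s₀ i′) τ)
      ≡⟨ ∑-+ (allFin (suc k)) (λ i′ → ⟦ merge s i ≟ merge s₀ i′ ⟧) (λ i′ → count (merge s₀ i′) τ) ⟩
    ∑[ i′ ∈ allFin (suc k) ] ⟦ merge s i ≟ merge s₀ i′ ⟧ + ∑[ i′ ∈ allFin (suc k) ] count (merge s₀ i′) τ
      ≡⟨ ≡.cong₂ _+_ (row-sum s i s₀) (count-merge-rows s₀ S σ) ⟩
    ⟦ s ≟ s₀ ⟧ + count s₀ S
      ≡⟨ count-∷ s₀ s S ⟨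
    count s₀ (s ∷ S) ∎
    where τ = Vec.zipWith merge S σ

  count-merge-columns : ∀ {n} i₀ (S : Vec (Fin 2) n) (σ : Vec (Fin (suc k)) n) →
                        count (merge zero i₀) (Vec.zipWith merge S σ) + count (merge (suc zero) i₀) (Vec.zipWith merge S σ)
                        ≡ count i₀ σ
  count-merge-columns i₀ [] [] = ≡.refl
  count-merge-columns i₀ (s ∷ S) (i ∷ σ) = begin
    count (merge zero i₀) (merge s i ∷ τ) + count (merge (suc zero) i₀) (merge s i ∷ τ)
      ≡⟨ ≡.cong₂ _+_ (count-∷ _ (merge s i) τ) (count-∷ _ (merge s i) τ) ⟩
    (⟦ merge s i ≟ merge zero i₀ ⟧ + count (merge zero i₀) τ) +
      (⟦ merge s i ≟ merge (suc zero) i₀ ⟧ + count (merge (suc zero) i₀) τ)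
      ≡⟨ CommSemigroupProps.interchange NatP.+-commutativeSemigroup
           ⟦ merge s i ≟ merge zero i₀ ⟧ (count (merge zero i₀) τ)
           ⟦ merge s i ≟ merge (suc zero) i₀ ⟧ (count (merge (suc zero) i₀) τ) ⟩
    (⟦ merge s i ≟ merge zero i₀ ⟧ + ⟦ merge s i ≟ merge (suc zero) i₀ ⟧) +
      (count (merge zero i₀) τ + count (merge (suc zero) i₀) τ)
      ≡⟨ ≡.cong₂ _+_ (column-sum s i i₀) (count-merge-columns i₀ S σ) ⟩
    ⟦ i ≟ i₀ ⟧ + count i₀ σ
      ≡⟨ count-∷ i₀ i σ ⟨
    count i₀ (i ∷ σ) ∎
    where τ = Vec.zipWith merge S σ

  gDegree-exponents : ∀ {n} (S : Vec (Fin 2) n) (σ : Vec (Fin (suc k)) n) →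
                      gDegree (exponents (Vec.zipWith merge S σ)) ≡ count (suc zero) S
  gDegree-exponents S σ = ≡.trans
    (∑-cong (allFin (suc k)) (λ i → lookup-exponents (Vec.zipWith merge S σ) (gVar i)))
    (count-merge-rows (suc zero) S σ)

  bDegrees-exponents : ∀ {n} (S : Vec (Fin 2) n) (σ : Vec (Fin (suc k)) n) →
                       bDegrees (exponents (Vec.zipWith merge S σ)) ≡ exponents σ
  bDegrees-exponents S σ = VecP.tabulate-cong λ h → ≡.trans
    (≡.cong₂ _+_ (lookup-exponents τ (bVar h)) (lookup-exponents τ (gVar (suc h))))
    (count-merge-columns (suc h) S σ)
    where τ = Vec.zipWith merge S σ

  zipWith-merge-injective : ∀ {n} {Sσ Sσ′ : Vec (Fin 2) n × Vec (Fin (suc k)) n} →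
                            uncurry (Vec.zipWith merge) Sσ ≡ uncurry (Vec.zipWith merge) Sσ′ → Sσ ≡ Sσ′
  zipWith-merge-injective {Sσ = [] , []} {[] , []} _ = ≡.refl
  zipWith-merge-injective {Sσ = s ∷ S , i ∷ σ} {s′ ∷ S′ , i′ ∷ σ′} eq
    with Equivalence.to merge≡merge⇔ (VecP.∷-injectiveˡ eq)
       | zipWith-merge-injective {Sσ = S , σ} {S′ , σ′} (VecP.∷-injectiveʳ eq)
  ... | ≡.refl , ≡.refl | ≡.refl = ≡.refl

  zipWith-merge-surjective : ∀ {n} (τ : Vec (Fin (suc (suc (k + k)))) n) →
                             Σ (Vec (Fin 2) n × Vec (Fin (suc k)) n) (λ Sσ → uncurry (Vec.zipWith merge) Sσ ≡ τ)
  zipWith-merge-surjective [] = ([] , []) , ≡.refl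
  zipWith-merge-surjective (l ∷ τ) with zipWith-merge-surjective τ
  ... | (S , σ) , ≡.refl =
    (proj₁ (unmerge l) ∷ S , proj₂ (unmerge l) ∷ σ) , ≡.cong (Vec._∷ Vec.zipWith merge S σ) (merge-unmerge l)

module Product {c ℓ : Level} (K : CommutativeRing c ℓ) (m : ℕ) where
  open CommutativeRing K renaming (Carrier to R) hiding (zero)
  open Model K m
  open FreeAlgebra K m
  open Counting K m
  open Elementary K m
  open import Relation.Binary.Reasoning.Setoid setoid

  coeff-concatMap-·T : ∀ {a b n} {A : Set a} {B : Set b} (f : A → T n) (g : B → T n)
                       (xs : List A) (ys : List B) (w : Basis n) →
    coeff _≟B_ (List.concatMap f xs ·T List.concatMap g ys) w ≈ ∑[ x ∈ xs ] ∑[ y ∈ ys ] coeff _≟B_ (f x ·T g y) w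
  coeff-concatMap-·T f g xs ys w = begin
    coeff _≟B_ (List.concatMap f xs ·T List.concatMap g ys) w
      ≈⟨ coeff-·T (List.concatMap f xs) (List.concatMap g ys) w ⟩
    ∑ (List.concatMap f xs) (λ p → ∑ (List.concatMap g ys) (Φ p))
      ≈⟨ ∑-concatMap f xs _ ⟩
    ∑[ x ∈ xs ] ∑[ p ∈ f x ] ∑ (List.concatMap g ys) (Φ p)
      ≈⟨ ∑-cong xs (λ x → ∑-cong (f x) (λ p → ∑-concatMap g ys (Φ p))) ⟩
    ∑[ x ∈ xs ] ∑[ p ∈ f x ] ∑[ y ∈ ys ] ∑ (g y) (Φ p)
      ≈⟨ ∑-cong xs (λ x → ∑-swap (f x) ys _) ⟩
    ∑[ x ∈ xs ] ∑[ y ∈ ys ] ∑[ p ∈ f x ] ∑ (g y) (Φ p)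
      ≈⟨ ∑-cong xs (λ x → ∑-cong ys (λ y → coeff-·T (f x) (g y) w)) ⟨
    ∑[ x ∈ xs ] ∑[ y ∈ ys ] coeff _≟B_ (f x ·T g y) w ∎
    where
    Φ : R × Basis _ → R × Basis _ → R
    Φ (r , u) (s , v) = (r * s) * ⟦ Vec.zipWith _++_ u v ≟B w ⟧

  coeff-e·e : ∀ n {k l} (b : Vec F k) (β : Vec ℕ k) (b′ : Vec F l) (β′ : Vec ℕ l) (w : Basis n) →
    coeff _≟B_ (e n b β ·T e n b′ β′) w ≈
    ∑[ S ∈ allVecs (suc k) n ] ∑[ σ ∈ allVecs (suc l) n ]
      ((⟦ exponents S ≟ℕs β ⟧ * ⟦ exponents σ ≟ℕs β′ ⟧) * ∏coeff (Vec.zipWith _·F_ (chosen b S) (chosen b′ σ)) w)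
  coeff-e·e n {k} {l} b β b′ β′ w = begin
    coeff _≟B_ (e n b β ·T e n b′ β′) w
      ≈⟨ coeff-concatMap-·T (⊗ ∘ chosen b) (⊗ ∘ chosen b′) (List.filter (λ S → exponents S ≟ℕs β) (allVecs (suc k) n))
                            (List.filter (λ σ → exponents σ ≟ℕs β′) (allVecs (suc l) n)) w ⟩
    ∑ (List.filter (λ S → exponents S ≟ℕs β) (allVecs (suc k) n)) (λ S →
      ∑ (List.filter (λ σ → exponents σ ≟ℕs β′) (allVecs (suc l) n)) (λ σ → tensorProduct S σ))
      ≈⟨ ∑-filter _ (allVecs (suc k) n) _ ⟩
    ∑[ S ∈ allVecs (suc k) n ] (⟦ exponents S ≟ℕs β ⟧ *
      ∑ (List.filter (λ σ → exponents σ ≟ℕs β′) (allVecs (suc l) n)) (λ σ → tensorProduct S σ))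
      ≈⟨ ∑-cong (allVecs (suc k) n) (λ S → *-congˡ (∑-filter _ (allVecs (suc l) n) _)) ⟩
    ∑[ S ∈ allVecs (suc k) n ] (⟦ exponents S ≟ℕs β ⟧ *
      ∑[ σ ∈ allVecs (suc l) n ] (⟦ exponents σ ≟ℕs β′ ⟧ * tensorProduct S σ))
      ≈⟨ ∑-cong (allVecs (suc k) n) (λ S → trans (∑-*ˡ (allVecs (suc l) n) _ _)
           (∑-cong (allVecs (suc l) n) (λ σ →
             trans (sym (*-assoc _ _ _)) (*-congˡ (coeff-⊗·⊗ (chosen b S) (chosen b′ σ) w))))) ⟩
    ∑[ S ∈ allVecs (suc k) n ] ∑[ σ ∈ allVecs (suc l) n ]
      ((⟦ exponents S ≟ℕs β ⟧ * ⟦ exponents σ ≟ℕs β′ ⟧) * ∏coeff (Vec.zipWith _·F_ (chosen b S) (chosen b′ σ)) w) ∎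
    where
    tensorProduct : Vec (Fin (suc k)) n → Vec (Fin (suc l)) n → R
    tensorProduct S σ = coeff _≟B_ (⊗ (chosen b S) ·T ⊗ (chosen b′ σ)) w

  ∑-by-exponents : ∀ n {k} (b : Vec F k) (h : Vec ℕ k → R) (w : Basis n) →
    ∑[ τ ∈ allVecs (suc k) n ] (h (exponents τ) * ∏coeff (chosen b τ) w) ≈
    ∑[ κ ∈ boundedVecs n k ] (h κ * coeff _≟B_ (e n b κ) w)
  ∑-by-exponents n {k} b h w = begin
    ∑[ τ ∈ allVecs (suc k) n ] (h (exponents τ) * ∏coeff (chosen b τ) w)
      ≈⟨ ∑-cong (allVecs (suc k) n) (λ τ →
           boundedVecs-sift (exponents τ) (exponents≤n τ) (λ κ → h κ * ∏coeff (chosen b τ) w)) ⟨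
    ∑[ τ ∈ allVecs (suc k) n ] ∑[ κ ∈ boundedVecs n k ] (⟦ κ ≟ℕs exponents τ ⟧ * (h κ * ∏coeff (chosen b τ) w))
      ≈⟨ ∑-swap (allVecs (suc k) n) (boundedVecs n k) _ ⟩
    ∑[ κ ∈ boundedVecs n k ] ∑[ τ ∈ allVecs (suc k) n ] (⟦ κ ≟ℕs exponents τ ⟧ * (h κ * ∏coeff (chosen b τ) w))
      ≈⟨ ∑-cong (boundedVecs n k) (λ κ →
           trans (∑-cong (allVecs (suc k) n) (reorder κ)) (sym (∑-*ˡ (allVecs (suc k) n) _ _))) ⟩
    ∑[ κ ∈ boundedVecs n k ] (h κ * ∑[ τ ∈ allVecs (suc k) n ] (⟦ exponents τ ≟ℕs κ ⟧ * ∏coeff (chosen b τ) w))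
      ≈⟨ ∑-cong (boundedVecs n k) (λ κ → *-congˡ (coeff-e n b κ w)) ⟨
    ∑[ κ ∈ boundedVecs n k ] (h κ * coeff _≟B_ (e n b κ) w) ∎
    where
    exponents≤n : ∀ τ i → Vec.lookup (exponents τ) i Nat.≤ n
    exponents≤n τ i = ≡.subst (Nat._≤ n) (≡.sym (lookup-exponents τ i)) (count≤length (suc i) τ)
    reorder : ∀ κ τ → ⟦ κ ≟ℕs exponents τ ⟧ * (h κ * ∏coeff (chosen b τ) w) ≈
                      h κ * (⟦ exponents τ ≟ℕs κ ⟧ * ∏coeff (chosen b τ) w)
    reorder κ τ = trans (*-congʳ (reflexive (⟦⟧-cong (mk⇔ ≡.sym ≡.sym) (κ ≟ℕs exponents τ) (exponents τ ≟ℕs κ))))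
      (trans (sym (*-assoc _ _ _)) (trans (*-congʳ (*-comm _ _)) (*-assoc _ _ _)))

  merged : ∀ {k} → F → Vec F k → Vec F (suc (k Nat.+ k))
  merged g b = g ∷ (b Vec.++ Vec.map (g ·F_) b)

  module Merged (g : F) {k : ℕ} (b : Vec F k) (j : ℕ) (β : Vec ℕ k) where
    open Merge k
    open Leading j β public
    open MergeCounting K m k

    choose-merged : ∀ s i → choose (merged g b) (merge s i) ≈F (choose (g ∷ []) s ·F choose b i)
    choose-merged zero zero w = sym (·F-identityˡ 1F w)
    choose-merged zero (suc h) w =
      trans (reflexive (≡.cong (λ f → coeff _≟W_ f w) (VecP.lookup-++ˡ b _ h))) (sym (·F-identityˡ (Vec.lookup b h) w))
    choose-merged (suc zero) zero w = sym (·F-identityʳ g w)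
    choose-merged (suc zero) (suc h) w =
      reflexive (≡.cong (λ f → coeff _≟W_ f w) (≡.trans (VecP.lookup-++ʳ b _ h) (VecP.lookup-map h (g ·F_) b)))

    ∏coeff-zipWith-merge : ∀ {n} (S : Vec (Fin 2) n) (σ : Vec (Fin (suc k)) n) (w : Basis n) →
      ∏coeff (Vec.zipWith _·F_ (chosen (g ∷ []) S) (chosen b σ)) w ≈ ∏coeff (chosen (merged g b) (Vec.zipWith merge S σ)) w
    ∏coeff-zipWith-merge [] [] [] = refl
    ∏coeff-zipWith-merge (s ∷ S) (i ∷ σ) (w ∷ ws) =
      *-cong (sym (choose-merged s i w)) (∏coeff-zipWith-merge S σ ws)

    ⟦mergedExponent⟧ : ∀ {n} (S : Vec (Fin 2) n) (σ : Vec (Fin (suc k)) n) →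
      ⟦ mergedExponent? (exponents (Vec.zipWith merge S σ)) ⟧ ≈ ⟦ exponents S ≟ℕs (j ∷ []) ⟧ * ⟦ exponents σ ≟ℕs β ⟧
    ⟦mergedExponent⟧ S σ = trans
      (reflexive (⟦⟧-cong (mk⇔
        (λ { (g≡j , b≡β) → ≡.cong (Vec._∷ []) (≡.trans (≡.sym (gDegree-exponents S σ)) g≡j) ,
                           ≡.trans (≡.sym (bDegrees-exponents S σ)) b≡β })
        (λ { (S≡j , σ≡β) → ≡.trans (gDegree-exponents S σ) (VecP.∷-injectiveˡ S≡j) ,
                           ≡.trans (bDegrees-exponents S σ) σ≡β }))
        (mergedExponent? (exponents (Vec.zipWith merge S σ))) ((exponents S ≟ℕs (j ∷ [])) ×-dec (exponents σ ≟ℕs β))))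
      (⟦⟧-× (exponents S ≟ℕs (j ∷ [])) (exponents σ ≟ℕs β))

    coeff-e₁·e : ∀ n (w : Basis n) → coeff _≟B_ (e₁ n j g ·T e n b β) w ≈
                 ∑[ κ ∈ boundedVecs n (suc (k Nat.+ k)) ] (⟦ mergedExponent? κ ⟧ * coeff _≟B_ (e n (merged g b) κ) w)
    coeff-e₁·e n w = begin
      coeff _≟B_ (e₁ n j g ·T e n b β) w
        ≈⟨ coeff-e·e n (g ∷ []) (j ∷ []) b β w ⟩
      ∑[ S ∈ allVecs 2 n ] ∑[ σ ∈ allVecs (suc k) n ] separate (S , σ)
        ≈⟨ ∑-cartesianProduct (allVecs 2 n) (allVecs (suc k) n) separate ⟨
      ∑ (cartesianProduct (allVecs 2 n) (allVecs (suc k) n)) separate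
        ≈⟨ ∑-cong (cartesianProduct (allVecs 2 n) (allVecs (suc k) n)) (λ { (S , σ) →
             *-cong (sym (⟦mergedExponent⟧ S σ)) (∏coeff-zipWith-merge S σ w) }) ⟩
      ∑[ Sσ ∈ cartesianProduct (allVecs 2 n) (allVecs (suc k) n) ] together (uncurry (Vec.zipWith merge) Sσ)
        ≈⟨ ∑-reindex (cartesianProduct-enumerates (allVecs-enumerates 2 n) (allVecs-enumerates (suc k) n))
                     (allVecs-enumerates _ n) (uncurry (Vec.zipWith merge)) zipWith-merge-injective together
                     (inj₁ ∘ zipWith-merge-surjective) ⟨
      ∑ (allVecs (suc (suc (k Nat.+ k))) n) together
        ≈⟨ ∑-by-exponents n (merged g b) (λ κ → ⟦ mergedExponent? κ ⟧) w ⟩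
      ∑[ κ ∈ boundedVecs n (suc (k Nat.+ k)) ] (⟦ mergedExponent? κ ⟧ * coeff _≟B_ (e n (merged g b) κ) w) ∎
      where
      separate : Vec (Fin 2) n × Vec (Fin (suc k)) n → R
      separate (S , σ) = (⟦ exponents S ≟ℕs (j ∷ []) ⟧ * ⟦ exponents σ ≟ℕs β ⟧) *
                         ∏coeff (Vec.zipWith _·F_ (chosen (g ∷ []) S) (chosen b σ)) w
      together : Vec (Fin (suc (suc (k Nat.+ k)))) n → R
      together τ = ⟦ mergedExponent? (exponents τ) ⟧ * ∏coeff (chosen (merged g b) τ) w

    e-leading : ∀ n → e n (merged g b) leading ≈T e n (g ∷ b) (j ∷ β)
    e-leading n = e-restrict n (_↑ˡ k) (λ {h} {h′} → FinP.↑ˡ-injective k h h′) leading (j ∷ β)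
      (λ h w → reflexive (≡.cong (λ f → coeff _≟W_ f w) (VecP.lookup-++ˡ (g ∷ b) _ h)))
      (λ h → VecP.lookup-++ˡ (j ∷ β) _ h) outside-zero
      where
      outside-zero : ∀ h → Σ (Fin (suc k)) (λ h′ → h′ ↑ˡ k ≡ h) ⊎ ((∀ h′ → h′ ↑ˡ k ≢ h) × Vec.lookup leading h ≡ 0)
      outside-zero h with Fin.splitAt (suc k) h in split≡
      ... | inj₁ h′ = inj₁ (h′ , FinP.splitAt⁻¹-↑ˡ split≡)
      ... | inj₂ h′ = inj₂ (not-left , ≡.trans
              (≡.cong (Vec.lookup leading) (≡.sym (FinP.splitAt⁻¹-↑ʳ {m = suc k} {n = k} {i = h} split≡)))
              (≡.trans (VecP.lookup-++ʳ (j ∷ β) _ h′) (VecP.lookup-replicate h′ 0)))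
        where
        not-left : ∀ h″ → h″ ↑ˡ k ≢ h
        not-left h″ eq
          with ≡.trans (≡.sym (FinP.splitAt-↑ˡ (suc k) h″ k)) (≡.trans (≡.cong (Fin.splitAt (suc k)) eq) split≡)
        ... | ()

    correcting? : ∀ κ → Dec (MergedExponent κ × ¬ κ ≡ leading)
    correcting? κ = mergedExponent? κ ×-dec ¬? (κ ≟ℕs leading)

    correction : ∀ n → Vec ℕ (suc (k Nat.+ k)) → T n
    correction n κ = keepIf (correcting? κ) (e n (merged g b) κ)

    e₁·e≈leading+corrections : ∀ n → j Nat.+ sumℕ β Nat.≤ n →
      (e₁ n j g ·T e n b β) ≈T (e n (g ∷ b) (j ∷ β) +T List.concatMap (correction n) (boundedVecs n (suc (k Nat.+ k))))
    e₁·e≈leading+corrections n ≤n w = begin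
      coeff _≟B_ (e₁ n j g ·T e n b β) w
        ≈⟨ coeff-e₁·e n w ⟩
      ∑[ κ ∈ κs ] (⟦ mergedExponent? κ ⟧ * E κ)
        ≈⟨ ∑-cong κs (λ κ → trans (*-congʳ (⟦⟧-split (λ { ≡.refl → leading-merged }) (mergedExponent? κ) (κ ≟ℕs leading)))
                                   (distribʳ (E κ) _ _)) ⟩
      ∑[ κ ∈ κs ] (⟦ κ ≟ℕs leading ⟧ * E κ + ⟦ correcting? κ ⟧ * E κ)
        ≈⟨ ∑-+ κs _ _ ⟩
      ∑[ κ ∈ κs ] (⟦ κ ≟ℕs leading ⟧ * E κ) + ∑[ κ ∈ κs ] (⟦ correcting? κ ⟧ * E κ)
        ≈⟨ +-cong (boundedVecs-sift leading leading≤n E)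
                  (∑-cong κs (λ κ → sym (coeff-keepIf _≟B_ (correcting? κ) (e n (merged g b) κ) w))) ⟩
      E leading + ∑[ κ ∈ κs ] coeff _≟B_ (correction n κ) w
        ≈⟨ +-cong (e-leading n w) (sym (coeff-concatMap _≟B_ (correction n) κs w)) ⟩
      coeff _≟B_ (e n (g ∷ b) (j ∷ β)) w + coeff _≟B_ (List.concatMap (correction n) κs) w
        ≈⟨ coeff-++ _≟B_ (e n (g ∷ b) (j ∷ β)) _ w ⟨
      coeff _≟B_ (e n (g ∷ b) (j ∷ β) +T List.concatMap (correction n) κs) w ∎
      where
      κs = boundedVecs n (suc (k Nat.+ k))
      E : Vec ℕ (suc (k Nat.+ k)) → R
      E κ = coeff _≟B_ (e n (merged g b) κ) w
      leading≤n : ∀ i → Vec.lookup leading i Nat.≤ n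
      leading≤n i = NatP.≤-trans (lookup≤sumℕ leading i) (≡.subst (Nat._≤ n) (≡.sym sumℕ-leading) ≤n)

module Subalgebra {c ℓ : Level} (K : CommutativeRing c ℓ) (m n ka : ℕ) (a : Vec (Model.F K m) ka) where
  open CommutativeRing K renaming (Carrier to R) hiding (zero)
  open Model K m
  open FreeAlgebra K m
  open Elementary K m
  open Product K m
  open import Relation.Binary.Reasoning.Setoid setoid

  Monomial : Set
  Monomial = Fin ka × List (Fin ka)

  ⟦_⟧ₘ : Monomial → F
  ⟦ j , js ⟧ₘ = mono a j js

  _·ₘ_ : Monomial → Monomial → Monomial
  (j , js) ·ₘ (j′ , js′) = j , js ++ j′ ∷ js′

  ⟦·ₘ⟧ : ∀ υ υ′ → ⟦ υ ·ₘ υ′ ⟧ₘ ≈F (⟦ υ ⟧ₘ ·F ⟦ υ′ ⟧ₘ)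
  ⟦·ₘ⟧ (j , js) υ′ = mono-++ j js
    where
    mono-++ : ∀ j js → mono a j (js ++ proj₁ υ′ ∷ proj₂ υ′) ≈F (mono a j js ·F ⟦ υ′ ⟧ₘ)
    mono-++ j [] w = refl
    mono-++ j (j₁ ∷ js) w = begin
      coeff _≟W_ (Vec.lookup a j ·F mono a j₁ (js ++ proj₁ υ′ ∷ proj₂ υ′)) w
        ≈⟨ ·F-congˡ (Vec.lookup a j) (mono-++ j₁ js) w ⟩
      coeff _≟W_ (Vec.lookup a j ·F (mono a j₁ js ·F ⟦ υ′ ⟧ₘ)) w
        ≈⟨ ·F-assoc (Vec.lookup a j) (mono a j₁ js) ⟦ υ′ ⟧ₘ w ⟨
      coeff _≟W_ ((Vec.lookup a j ·F mono a j₁ js) ·F ⟦ υ′ ⟧ₘ) w ∎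

  Sub : T n → Set (c ⊔ ℓ)
  Sub = InSubalg n a

  ∈-[] : Sub []
  ∈-[] = resp (λ w → trans (coeff-• 0# (1T {n}) w) (zeroˡ _)) (scal 0# unit)

  ∈-concatMap : ∀ {b} {B : Set b} (f : B → T n) (xs : List B) → (∀ x → Sub (f x)) → Sub (List.concatMap f xs)
  ∈-concatMap f [] _ = ∈-[]
  ∈-concatMap f (x ∷ xs) f∈ = add (f∈ x) (∈-concatMap f xs f∈)

  ∈-keepIf : ∀ {p} {P : Set p} (P? : Dec P) {x : T n} → (P → Sub x) → Sub (keepIf P? x)
  ∈-keepIf (yes p) x∈ = x∈ p
  ∈-keepIf (no _) _ = ∈-[]

  ∈-cancel : ∀ {x y z : T n} → Sub x → Sub y → x ≈T (z +T y) → Sub z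
  ∈-cancel {x} {y} {z} x∈ y∈ x≈z+y = resp x-y≈z (add x∈ (scal (- 1#) y∈))
    where
    x-y≈z : (x +T ((- 1#) •T y)) ≈T z
    x-y≈z w = begin
      coeff _≟B_ (x +T ((- 1#) •T y)) w
        ≈⟨ trans (coeff-++ _≟B_ x _ w) (+-cong (x≈z+y w) (coeff-• (- 1#) y w)) ⟩
      coeff _≟B_ (z +T y) w + - 1# * coeff _≟B_ y w
        ≈⟨ +-cong (coeff-++ _≟B_ z y w) (RingProps.-1*x≈-x ring _) ⟩
      (coeff _≟B_ z w + coeff _≟B_ y w) - coeff _≟B_ y w
        ≈⟨ +-assoc _ _ _ ⟩
      coeff _≟B_ z w + (coeff _≟B_ y w - coeff _≟B_ y w)
        ≈⟨ +-congˡ (-‿inverseʳ _) ⟩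
      coeff _≟B_ z w + 0#
        ≈⟨ +-identityʳ _ ⟩
      coeff _≟B_ z w ∎

  mergedₘ : ∀ {k} → Monomial → Vec Monomial k → Vec Monomial (suc (k Nat.+ k))
  mergedₘ υ υs = υ ∷ (υs Vec.++ Vec.map (υ ·ₘ_) υs)

  lookup-++-map-cong : ∀ {b} {B : Set b} {f g : B → F} → (∀ x → f x ≈F g x) →
                       ∀ {l k} (xs : Vec F l) (ys : Vec B k) i →
                       Vec.lookup (xs Vec.++ Vec.map f ys) i ≈F Vec.lookup (xs Vec.++ Vec.map g ys) i
  lookup-++-map-cong {f = f} {g} f≈g [] ys i w = begin
    coeff _≟W_ (Vec.lookup (Vec.map f ys) i) w   ≡⟨ ≡.cong (λ h → coeff _≟W_ h w) (VecP.lookup-map i f ys) ⟩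
    coeff _≟W_ (f (Vec.lookup ys i)) w           ≈⟨ f≈g (Vec.lookup ys i) w ⟩
    coeff _≟W_ (g (Vec.lookup ys i)) w           ≡⟨ ≡.cong (λ h → coeff _≟W_ h w) (VecP.lookup-map i g ys) ⟨
    coeff _≟W_ (Vec.lookup (Vec.map g ys) i) w   ∎
  lookup-++-map-cong f≈g (x ∷ xs) ys zero w = refl
  lookup-++-map-cong f≈g (x ∷ xs) ys (suc i) = lookup-++-map-cong f≈g xs ys i

  ⟦mergedₘ⟧ : ∀ {k} (υ : Monomial) (υs : Vec Monomial k) →
              ∀ i → Vec.lookup (Vec.map ⟦_⟧ₘ (mergedₘ υ υs)) i ≈F Vec.lookup (merged ⟦ υ ⟧ₘ (Vec.map ⟦_⟧ₘ υs)) i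
  ⟦mergedₘ⟧ υ υs zero w = refl
  ⟦mergedₘ⟧ υ υs (suc i) w = begin
    coeff _≟W_ (Vec.lookup (Vec.map ⟦_⟧ₘ (υs Vec.++ Vec.map (υ ·ₘ_) υs)) i) w
      ≡⟨ ≡.cong (λ fs → coeff _≟W_ (Vec.lookup fs i) w)
           (≡.trans (VecP.map-++ ⟦_⟧ₘ υs _) (≡.cong (Vec.map ⟦_⟧ₘ υs Vec.++_) (≡.sym (VecP.map-∘ ⟦_⟧ₘ (υ ·ₘ_) υs)))) ⟩
    coeff _≟W_ (Vec.lookup (Vec.map ⟦_⟧ₘ υs Vec.++ Vec.map (⟦_⟧ₘ ∘ (υ ·ₘ_)) υs) i) w
      ≈⟨ lookup-++-map-cong (⟦·ₘ⟧ υ) (Vec.map ⟦_⟧ₘ υs) υs i w ⟩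
    coeff _≟W_ (Vec.lookup (Vec.map ⟦_⟧ₘ υs Vec.++ Vec.map ((⟦ υ ⟧ₘ ·F_) ∘ ⟦_⟧ₘ) υs) i) w
      ≡⟨ ≡.cong (λ fs → coeff _≟W_ (Vec.lookup (Vec.map ⟦_⟧ₘ υs Vec.++ fs) i) w) (VecP.map-∘ (⟦ υ ⟧ₘ ·F_) ⟦_⟧ₘ υs) ⟩
    coeff _≟W_ (Vec.lookup (Vec.map ⟦_⟧ₘ υs Vec.++ Vec.map (⟦ υ ⟧ₘ ·F_) (Vec.map ⟦_⟧ₘ υs)) i) w ∎

  e-of-monomials-∈ : ∀ {k} (υs : Vec Monomial k) (β : Vec ℕ k) → sumℕ β Nat.≤ n → Acc Nat._<_ (sumℕ β) →
                     Sub (e n (Vec.map ⟦_⟧ₘ υs) β)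
  e-of-monomials-∈ [] [] _ _ = resp (λ w → sym (e-empty n w)) unit
  e-of-monomials-∈ (υ ∷ υs) (zero ∷ β) β≤n rec =
    resp (λ w → sym (e-∷-zero n ⟦ υ ⟧ₘ (Vec.map ⟦_⟧ₘ υs) β w)) (e-of-monomials-∈ υs β β≤n rec)
  e-of-monomials-∈ (υ@(j₀ , js₀) ∷ υs) (suc j ∷ β) β≤n (acc rec) =
    ∈-cancel product∈ corrections∈ (e₁·e≈leading+corrections n β≤n)
    where
    open Merged ⟦ υ ⟧ₘ (Vec.map ⟦_⟧ₘ υs) (suc j) β
    product∈ : Sub (e₁ n (suc j) ⟦ υ ⟧ₘ ·T e n (Vec.map ⟦_⟧ₘ υs) β)
    product∈ = mul (gen (suc j) (s≤s z≤n) (NatP.≤-trans (NatP.m≤m+n (suc j) _) β≤n) j₀ js₀)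
                   (e-of-monomials-∈ υs β (NatP.≤-trans (NatP.m≤n+m _ (suc j)) β≤n) (rec (s≤s (NatP.m≤n+m _ j))))
    corrections∈ : Sub (List.concatMap (correction n) (boundedVecs n _))
    corrections∈ = ∈-concatMap (correction n) (boundedVecs n _) λ κ → ∈-keepIf (correcting? κ) λ (merged-κ , κ≢leading) →
      let κ< = smaller-unless-leading κ merged-κ κ≢leading
      in resp (e-cong n κ (⟦mergedₘ⟧ υ υs)) (e-of-monomials-∈ (mergedₘ υ υs) κ (NatP.≤-trans (NatP.<⇒≤ κ<) β≤n) (rec κ<))

  letters : Vec Monomial ka
  letters = Vec.tabulate (λ i → i , [])

  ⟦letters⟧ : Vec.map ⟦_⟧ₘ letters ≡ a
  ⟦letters⟧ = ≡.trans (≡.sym (VecP.tabulate-∘ ⟦_⟧ₘ (λ i → i , []))) (VecP.tabulate∘lookup a)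

mainTheorem15 : {c ℓ : Level} (K : CommutativeRing c ℓ) (m n k : ℕ) →
    1 ≤ n → (a : Vec (Model.F K m) k) (α : Vec ℕ k) →
    sumℕ α ≤ n →
    Model.InSubalg K m n a (Model.e K m n a α)
mainTheorem15 K m n k _ a α α≤n =
  ≡.subst (λ b → InSubalg n a (e n b α)) ⟦letters⟧ (e-of-monomials-∈ letters α α≤n (<-wellFounded (sumℕ α)))
  where
  open Model K m
  open Subalgebra K m n k a
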